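{- For every weak composition $\mu$, the set $\{\wedge(\sigma)\mid \sigma\in\mathsf{Ninc}_\mu\}$ is a basis of $\mathcal{L}(\mu)$. Consequently $\dim\mathcal{L}(\mu)=|\mathsf{Ninc}_\mu|$.
   Context: Let $\mathbf{k}$ be a field of characteristic $\neq2$, $\mathbb{P}$ the positive integers. A colored letter is $x^i=(x,i)\in[n]\times\mathbb{P}$ with color $i$. A weak composition is a sequence $\mu=(\mu(1),\mu(2),\dots)$ of nonnegative integers with $|\mu|=\sum\mu(i)<\infty$. A colored permutation of $[n]$ is a word $\sigma=\sigma(1)\cdots\sigma(n)$ of colored letters whose uncolored letters form a permutation of $[n]$; its content counts letters of each color; $\mathfrak{S}_\mu$ is the set of colored permutations of $[|\mu|]$ with content $\mu$. Let $W$ have basis $[n]\times\mathbb{P}$ and let $\Lambda=T(W)/I$ where $I$ is the ideal generated by $x^i\otimes y^i+y^i\otimes x^i$ and $x^i\otimes y^j+y^i\otimes x^j+y^j\otimes x^i+x^j\otimes y^i$ for all $x,y\in[n]$, $i,j\in\mathbb{P}$; $\wedge(\sigma)=\sigma(1)\wedge\cdots\wedge\sigma(n)$ is the image of $\sigma(1)\otimes\cdots\otimes\sigma(n)$, and $\mathcal{L}(\mu)$ is the span of $\{\wedge(\sigma):\sigma\in\mathfrak{S}_\mu\}$. An ascent of a colored permutation $\sigma$ is an $i\in[n-1]$ such that the uncolored letter of $\sigma(i)$ is less than that of $\sigma(i+1)$ and the color of $\sigma(i)$ is $\le$ the color of $\sigma(i+1)$. A colored permutation is nonincreasing if it has no ascents;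 $\mathsf{Ninc}_\mu$ is the set of nonincreasing colored permutations in $\mathfrak{S}_\mu$. -}

module Defs where

open import Level using (Level; _⊔_) renaming (suc to lsuc)
open import Algebra.Bundles using (CommutativeRing)
open import Data.Nat as ℕ using (ℕ; zero; suc)
open import Data.Fin using (Fin; toℕ)
import Data.Fin.Properties as FinP
import Data.Nat.Properties as ℕP
open import Data.Vec using (Vec; lookup; toList)
open import Data.List using (List; []; _∷_; _++_; map; concatMap; filter; length)
open import Data.Nat.ListAction using (sum)
import Data.List.Properties as ListP
open import Data.List.Relation.Unary.All using (All)
open import Data.List.Relation.Unary.Unique.Propositional using (Unique)
open import Data.Product using (Σ; ∃; _×_; _,_; proj₁; proj₂)
import Data.Product.Properties as ProdP
open import Relation.Nullary using (¬_; Dec; yes; no)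
open import Relation.Binary.PropositionalEquality using (_≡_)

record Field (c ℓ : Level) : Set (lsuc (c ⊔ ℓ)) where
  field
    commutativeRing : CommutativeRing c ℓ
  open CommutativeRing commutativeRing public
  field
    1≉0     : ¬ (1# ≈ 0#)
    inverse : ∀ x → ¬ (x ≈ 0#) → ∃ λ y → x * y ≈ 1#

CharNot2 : ∀ {c ℓ} → Field c ℓ → Set ℓ
CharNot2 F = ¬ ((1# + 1#) ≈ 0#)
  where open Field F

-- Weak compositions: μ is given by the finite list (μ(1), μ(2), …, μ(m)),
-- all later entries being 0.  Colors are encoded 0-based: the natural
-- number k stands for the color k+1 ∈ ℙ.  Thus μAt μ k = μ(k+1).

WeakComp : Set
WeakComp = List ℕ

μAt : WeakComp → ℕ → ℕ
μAt []       _       = 0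
μAt (m ∷ μ)  zero    = m
μAt (m ∷ μ)  (suc k) = μAt μ k

∣_∣ : WeakComp → ℕ
∣ μ ∣ = sum μ

-- Colored letters over [n]: (x , k) with x : Fin n standing for the
-- letter toℕ x + 1 ∈ [n], and k : ℕ standing for the color k + 1 ∈ ℙ.

Letter : ℕ → Set
Letter n = Fin n × ℕ

letter : ∀ {n} → Letter n → Fin n
letter = proj₁

color : ∀ {n} → Letter n → ℕ
color = proj₂

Word : ℕ → Set
Word n = List (Letter n)

_≟W_ : ∀ {n} → (u v : Word n) → Dec (u ≡ v)
_≟W_ = ListP.≡-dec (ProdP.≡-dec FinP._≟_ ℕP._≟_)

CWord : ℕ → Set
CWord n = Vec (Letter n) n

IsColoredPerm : ∀ {n} → CWord n → Set
IsColoredPerm {n} σ = ∀ (i j : Fin n) → letter (lookup σ i) ≡ letter (lookup σ j) → i ≡ j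

countColor : ∀ {n} → ℕ → CWord n → ℕ
countColor k σ = length (filter (λ a → color a ℕP.≟ k) (toList σ))

HasContent : ∀ {n} → WeakComp → CWord n → Set
HasContent μ σ = ∀ k → countColor k σ ≡ μAt μ k

In𝔖 : (μ : WeakComp) → CWord ∣ μ ∣ → Set
In𝔖 μ σ = IsColoredPerm σ × HasContent μ σ

Ascent : ∀ {n} → CWord n → Set
Ascent {n} σ = Σ (Fin n) λ i → Σ (Fin n) λ j →
  (toℕ j ≡ suc (toℕ i)) ×
  (toℕ (letter (lookup σ i)) ℕ.< toℕ (letter (lookup σ j))) ×
  (color (lookup σ i) ℕ.≤ color (lookup σ j))

InNinc : (μ : WeakComp) → CWord ∣ μ ∣ → Set
InNinc μ σ = In𝔖 μ σ × ¬ Ascent σ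

-- The tensor algebra T(W) over a field, W having basis [n] × ℙ:
-- T(W) is the free vector space on words, and an element is represented
-- by a finite formal sum (list of (coefficient, word)), two formal sums
-- being equal iff every word has the same total coefficient.

module TensorAlgebra {c ℓ} (F : Field c ℓ) (n : ℕ) where
  open Field F

  FS : Set c
  FS = List (Carrier × Word n)

  coeff : Word n → FS → Carrier
  coeff w []             = 0#
  coeff w ((a , u) ∷ s) with u ≟W w
  ... | yes _ = a + coeff w s
  ... | no  _ = coeff w s

  _≋_ : FS → FS → Set ℓ
  s ≋ t = ∀ w → coeff w s ≈ coeff w t

  ⊗w : Word n → FS
  ⊗w w = (1# , w) ∷ []

  _−_ : FS → FS → FS
  s − t = s ++ map (λ p → (- proj₁ p , proj₂ p)) t

  data Gen : Set where
    rel₁ : (x y : Fin n) (i : ℕ) → Gen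
    rel₂ : (x y : Fin n) (i j : ℕ) → Gen

  genFS : Gen → FS
  genFS (rel₁ x y i)   = (1# , (x , i) ∷ (y , i) ∷ []) ∷ (1# , (y , i) ∷ (x , i) ∷ []) ∷ []
  genFS (rel₂ x y i j) =
    (1# , (x , i) ∷ (y , j) ∷ []) ∷ (1# , (y , i) ∷ (x , j) ∷ []) ∷
    (1# , (y , j) ∷ (x , i) ∷ []) ∷ (1# , (x , j) ∷ (y , i) ∷ []) ∷ []

  expand : List (Carrier × Word n × Gen × Word n) → FS
  expand = concatMap (λ { (a , u , g , v) → map (λ { (b , w) → (a * b , u ++ w ++ v) }) (genFS g) })

  InI : FS → Set (c ⊔ ℓ)
  InI s = ∃ λ ws → s ≋ expand ws

-- The theorem's conclusion: {∧(σ) | σ ∈ Ninc_μ} is a basis of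
-- 𝓛(μ) = span{∧(σ) | σ ∈ 𝔖_μ} ⊆ Λ = T(W)/I.

module _ {c ℓ} (F : Field c ℓ) (μ : WeakComp) where
  open Field F
  open TensorAlgebra F ∣ μ ∣

  combo : List (Carrier × CWord ∣ μ ∣) → FS
  combo = map (λ p → (proj₁ p , toList (proj₂ p)))

  NincLinIndep : Set (c ⊔ ℓ)
  NincLinIndep = ∀ (L : List (Carrier × CWord ∣ μ ∣)) →
    Unique (map proj₂ L) →
    All (λ p → InNinc μ (proj₂ p)) L →
    InI (combo L) →
    All (λ p → proj₁ p ≈ 0#) L

  -- every generator ∧(σ), σ ∈ 𝔖_μ, of 𝓛(μ) is a linear combination in Λ
  -- of the ∧(τ), τ ∈ Ninc_μ
  NincSpans : Set (c ⊔ ℓ)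
  NincSpans = ∀ (σ : CWord ∣ μ ∣) → In𝔖 μ σ →
    ∃ λ (L : List (Carrier × CWord ∣ μ ∣)) →
      All (λ p → InNinc μ (proj₂ p)) L × InI (⊗w (toList σ) − combo L)

  NincIsBasis : Set (c ⊔ ℓ)
  NincIsBasis = NincLinIndep × NincSpans

-- Cut a nonincreasing word τ into the maximal runs on which its letters
-- decrease and those on which they increase; on the latter its colors decrease, as τ has
-- no ascent. For a word w let f_τ(w) be the product, over the runs of the first kind, of
-- the sign of the permutation carrying the letters of w in that segment onto those of τ,
-- times the same product over the runs of the second kind with colors in place of letters
-- (0 if some segment is not a rearrangement). Every two neighbouring positions of τ lie in
-- one run, so f_τ is alternating in the letters or in the colors there and vanishes on
-- both kinds of defining relations of I. Moreover f_τ(τ) = 1, and f_τ(σ) ≠ 0 forces σ ≤ τ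
-- lexicographically on (letters, colors): the matrix (f_τ(σ)) is unitriangular.
--
-- At an ascent x^i y^j a defining relation of I expresses ∧(σ) through words
-- with fewer increasing pairs (counted among the letters plus among the colors), so
-- rewriting terminates at nonincreasing words.

module Submission where

open import Defs

open import Level using (_⊔_)
open import Data.Bool using (true; false; if_then_else_)
open import Data.Empty using (⊥-elim)
open import Data.Nat as ℕ using (ℕ; zero; suc; _∸_; _<_; _≤_; _>_; z≤n; s≤s)
import Data.Nat.Properties as ℕP
open import Data.Fin using (zero; suc; toℕ)
import Data.Fin.Properties as FinP
open import Data.Vec using (Vec; []; _∷_; toList; lookup)
import Data.Vec.Properties as VecP
open import Data.Vec.Relation.Binary.Equality.Cast using (cast-is-id)
open import Data.Product using (Σ; ∃; _×_; _,_; proj₁; proj₂)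
open import Data.Sum using (_⊎_; inj₁; inj₂)
open import Data.List using (List; []; _∷_; _++_; map; concat; take; drop; length; filter)
import Data.List.Properties as ListP
open ListP using (filter-accept; filter-reject)
open import Data.List.Relation.Unary.All as All using (All; []; _∷_)
import Data.List.Relation.Unary.All.Properties as AllP
open import Data.List.Relation.Unary.AllPairs using (AllPairs; []; _∷_)
open import Data.List.Relation.Unary.Linked as Linked using (Linked; []; [-]; _∷_)
open import Data.List.Relation.Binary.Pointwise using (Pointwise-≡⇒≡; ≡⇒Pointwise-≡)
open import Data.List.Relation.Unary.Unique.Propositional using (Unique)
open import Data.List.Relation.Binary.Lex.Strict as Lex using (Lex-≤; base; halt; this; next)
import Data.List.Relation.Binary.Permutation.Propositional.Properties as PermP
open import Relation.Binary.Definitions using (tri<; tri≈; tri>)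
open import Relation.Binary.Properties.DecTotalOrder ℕP.≤-decTotalOrder using (≥-decTotalOrder)
open import Data.List.Sort.InsertionSort.Base ≥-decTotalOrder
  renaming (insert to insertDesc; sort to sortDesc)
open import Data.List.Sort.InsertionSort.Properties ≥-decTotalOrder using (insert-swap; sort-↭)
open import Relation.Nullary using (¬_; Dec; yes; no; does)
open import Relation.Nullary.Decidable using (dec-true; dec-false; _×-dec_; ¬?)
open import Relation.Binary.PropositionalEquality
  using (_≡_; _≢_; refl; sym; trans; cong; cong₂; subst; subst₂; isEquivalence; module ≡-Reasoning)
open import Induction.WellFounded using (Acc; acc)
open import Data.Nat.Induction using (<-wellFounded)

data Sign : Set where
  pos neg nul : Sign

opposite : Sign → Sign
opposite pos = neg
opposite neg = pos
opposite nul = nul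

infixl 7 _⊙_
_⊙_ : Sign → Sign → Sign
pos ⊙ b = b
neg ⊙ b = opposite b
nul ⊙ _ = nul

opposite-involutive : ∀ a → opposite (opposite a) ≡ a
opposite-involutive pos = refl
opposite-involutive neg = refl
opposite-involutive nul = refl

⊙-zeroʳ : ∀ a → a ⊙ nul ≡ nul
⊙-zeroʳ pos = refl
⊙-zeroʳ neg = refl
⊙-zeroʳ nul = refl

opposite-⊙ˡ : ∀ a b → opposite a ⊙ b ≡ opposite (a ⊙ b)
opposite-⊙ˡ pos b = refl
opposite-⊙ˡ neg b = sym (opposite-involutive b)
opposite-⊙ˡ nul b = refl

opposite-⊙ʳ : ∀ a b → a ⊙ opposite b ≡ opposite (a ⊙ b)
opposite-⊙ʳ pos b = refl
opposite-⊙ʳ neg b = refl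
opposite-⊙ʳ nul b = refl

⊙-assoc : ∀ a b c → (a ⊙ b) ⊙ c ≡ a ⊙ (b ⊙ c)
⊙-assoc pos b c = refl
⊙-assoc neg b c = opposite-⊙ˡ b c
⊙-assoc nul b c = refl

⊙-identityʳ : ∀ a → a ⊙ pos ≡ a
⊙-identityʳ pos = refl
⊙-identityʳ neg = refl
⊙-identityʳ nul = refl

⊙-comm : ∀ a b → a ⊙ b ≡ b ⊙ a
⊙-comm pos b = sym (⊙-identityʳ b)
⊙-comm neg b = sym (trans (opposite-⊙ʳ b pos) (cong opposite (⊙-identityʳ b)))
⊙-comm nul b = sym (⊙-zeroʳ b)

⊙-lcomm : ∀ a b c → a ⊙ (b ⊙ c) ≡ b ⊙ (a ⊙ c)
⊙-lcomm a b c = begin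
  a ⊙ (b ⊙ c) ≡⟨ sym (⊙-assoc a b c) ⟩
  a ⊙ b ⊙ c   ≡⟨ cong (_⊙ c) (⊙-comm a b) ⟩
  b ⊙ a ⊙ c   ≡⟨ ⊙-assoc b a c ⟩
  b ⊙ (a ⊙ c) ∎
  where open ≡-Reasoning

⊙-nonzeroˡ : ∀ a b → a ⊙ b ≢ nul → a ≢ nul
⊙-nonzeroˡ a b ab≢0 refl = ab≢0 refl

⊙-nonzeroʳ : ∀ a b → a ⊙ b ≢ nul → b ≢ nul
⊙-nonzeroʳ a b ab≢0 refl = ab≢0 (⊙-zeroʳ a)

opposite-fixed⇒nul : ∀ a → a ≡ opposite a → a ≡ nul
opposite-fixed⇒nul pos ()
opposite-fixed⇒nul neg ()
opposite-fixed⇒nul nul _ = refl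

nul? : ∀ a → a ≡ nul ⊎ a ≢ nul
nul? pos = inj₂ λ ()
nul? neg = inj₂ λ ()
nul? nul = inj₁ refl

compareSign : ℕ → ℕ → Sign
compareSign a b with ℕP.<-cmp a b
... | tri< _ _ _ = neg
... | tri≈ _ _ _ = nul
... | tri> _ _ _ = pos

compareSign-anti : ∀ a b → compareSign b a ≡ opposite (compareSign a b)
compareSign-anti a b with ℕP.<-cmp a b | ℕP.<-cmp b a
... | tri< _ _ _ | tri> _ _ _ = refl
... | tri≈ _ _ _ | tri≈ _ _ _ = refl
... | tri> _ _ _ | tri< _ _ _ = refl
... | tri< a<b _ _ | tri< _ _ a≮b = ⊥-elim (a≮b a<b)
... | tri< a<b _ _ | tri≈ _ _ a≮b = ⊥-elim (a≮b a<b)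
... | tri≈ _ a≡b _ | tri< _ b≢a _ = ⊥-elim (b≢a (sym a≡b))
... | tri≈ _ a≡b _ | tri> _ b≢a _ = ⊥-elim (b≢a (sym a≡b))
... | tri> _ _ b<a | tri≈ b≮a _ _ = ⊥-elim (b≮a b<a)
... | tri> _ _ b<a | tri> b≮a _ _ = ⊥-elim (b≮a b<a)

compareSign-> : ∀ {a b} → a > b → compareSign a b ≡ pos
compareSign-> {a} {b} a>b with ℕP.<-cmp a b
... | tri< _ _ a≯b = ⊥-elim (a≯b a>b)
... | tri≈ _ _ a≯b = ⊥-elim (a≯b a>b)
... | tri> _ _ _ = refl

rowSign : ℕ → List ℕ → Sign
rowSign a []      = pos
rowSign a (b ∷ s) = compareSign a b ⊙ rowSign a s

listSign : List ℕ → Sign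
listSign []      = pos
listSign (a ∷ s) = rowSign a s ⊙ listSign s

rowSign-swap : ∀ c p a b q → rowSign c (p ++ a ∷ b ∷ q) ≡ rowSign c (p ++ b ∷ a ∷ q)
rowSign-swap c []      a b q = ⊙-lcomm (compareSign c a) (compareSign c b) (rowSign c q)
rowSign-swap c (d ∷ p) a b q = cong (compareSign c d ⊙_) (rowSign-swap c p a b q)

listSign-swap : ∀ p a b q → listSign (p ++ a ∷ b ∷ q) ≡ opposite (listSign (p ++ b ∷ a ∷ q))
listSign-swap [] a b q = begin
  (x ⊙ A) ⊙ (B ⊙ S)                       ≡⟨ ⊙-assoc x A (B ⊙ S) ⟩
  x ⊙ (A ⊙ (B ⊙ S))                       ≡⟨ cong (x ⊙_) (⊙-lcomm A B S) ⟩
  x ⊙ (B ⊙ (A ⊙ S))                       ≡⟨ sym (⊙-assoc x B (A ⊙ S)) ⟩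
  (x ⊙ B) ⊙ (A ⊙ S)                       ≡⟨ sym (opposite-involutive _) ⟩
  opposite (opposite ((x ⊙ B) ⊙ (A ⊙ S))) ≡⟨ cong opposite (sym (opposite-⊙ˡ (x ⊙ B) (A ⊙ S))) ⟩
  opposite (opposite (x ⊙ B) ⊙ (A ⊙ S))   ≡⟨ cong (λ z → opposite (z ⊙ (A ⊙ S))) (sym (opposite-⊙ˡ x B)) ⟩
  opposite ((opposite x ⊙ B) ⊙ (A ⊙ S))   ≡⟨ cong (λ z → opposite ((z ⊙ B) ⊙ (A ⊙ S))) (sym (compareSign-anti a b)) ⟩
  opposite ((compareSign b a ⊙ B) ⊙ (A ⊙ S)) ∎
  where
  open ≡-Reasoning
  x = compareSign a b
  A = rowSign a q
  B = rowSign b q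
  S = listSign q
listSign-swap (c ∷ p) a b q = begin
  rowSign c (p ++ a ∷ b ∷ q) ⊙ listSign (p ++ a ∷ b ∷ q)
    ≡⟨ cong₂ _⊙_ (rowSign-swap c p a b q) (listSign-swap p a b q) ⟩
  rowSign c (p ++ b ∷ a ∷ q) ⊙ opposite (listSign (p ++ b ∷ a ∷ q))
    ≡⟨ opposite-⊙ʳ (rowSign c (p ++ b ∷ a ∷ q)) (listSign (p ++ b ∷ a ∷ q)) ⟩
  opposite (rowSign c (p ++ b ∷ a ∷ q) ⊙ listSign (p ++ b ∷ a ∷ q)) ∎
  where open ≡-Reasoning

Decreasing : List ℕ → Set
Decreasing = AllPairs _>_

rowSign-below : ∀ {a t} → All (a >_) t → rowSign a t ≡ pos
rowSign-below []           = refl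
rowSign-below (a>b ∷ a>bs) = trans (cong (_⊙ _) (compareSign-> a>b)) (rowSign-below a>bs)

listSign-decreasing : ∀ {t} → Decreasing t → listSign t ≡ pos
listSign-decreasing []           = refl
listSign-decreasing (a>t ∷ t↘) = trans (cong (_⊙ _) (rowSign-below a>t)) (listSign-decreasing t↘)

infix 4 _≤ₗ_
_≤ₗ_ : List ℕ → List ℕ → Set
_≤ₗ_ = Lex-≤ _≡_ _<_

≤ₗ-refl : ∀ s → s ≤ₗ s
≤ₗ-refl s = Lex.≤-reflexive _≡_ _<_ (≡⇒Pointwise-≡ refl)

≤ₗ-trans : ∀ {s t u} → s ≤ₗ t → t ≤ₗ u → s ≤ₗ u
≤ₗ-trans = Lex.≤-transitive isEquivalence ℕP.<-resp₂-≡ ℕP.<-trans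

≤ₗ-antisym : ∀ {s t} → s ≤ₗ t → t ≤ₗ s → s ≡ t
≤ₗ-antisym s≤t t≤s = Pointwise-≡⇒≡ (Lex.≤-antisymmetric sym ℕP.<-irrefl ℕP.<-asym s≤t t≤s)

≤ₗ-total : ∀ s t → s ≤ₗ t ⊎ t ≤ₗ s
≤ₗ-total = Lex.≤-total sym ℕP.<-cmp

≤ₗ-++ : ∀ {s₁ t₁ s₂ t₂} → length s₁ ≡ length t₁ → s₁ ≤ₗ t₁ → s₂ ≤ₗ t₂ → s₁ ++ s₂ ≤ₗ t₁ ++ t₂
≤ₗ-++ _  (base _)      s₂≤t₂ = s₂≤t₂
≤ₗ-++ () halt          _
≤ₗ-++ _  (this a<b)    _     = this a<b
≤ₗ-++ eq (next a≡b s≤t) s₂≤t₂ = next a≡b (≤ₗ-++ (ℕP.suc-injective eq) s≤t s₂≤t₂)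

insertDesc-≥ : ∀ {a h} r → h ≤ a → insertDesc a (h ∷ r) ≡ a ∷ h ∷ r
insertDesc-≥ {a} {h} r h≤a rewrite dec-true (h ℕP.≤? a) h≤a = refl

insertDesc-< : ∀ {a h} r → a < h → insertDesc a (h ∷ r) ≡ h ∷ insertDesc a r
insertDesc-< {a} {h} r a<h rewrite dec-false (h ℕP.≤? a) (ℕP.<⇒≱ a<h) = refl

cons-≤ₗ-insertDesc : ∀ a r → a ∷ r ≤ₗ insertDesc a r
cons-≤ₗ-insertDesc a []      = ≤ₗ-refl _
cons-≤ₗ-insertDesc a (h ∷ r) with ℕP.≤-<-connex h a
... | inj₁ h≤a rewrite insertDesc-≥ r h≤a = ≤ₗ-refl _
... | inj₂ a<h rewrite insertDesc-< r a<h = this a<h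

≤ₗ-sortDesc : ∀ s → s ≤ₗ sortDesc s
≤ₗ-sortDesc []      = base _
≤ₗ-sortDesc (a ∷ s) = ≤ₗ-trans (next refl (≤ₗ-sortDesc s)) (cons-≤ₗ-insertDesc a (sortDesc s))

sortDesc-swap : ∀ p a b q → sortDesc (p ++ a ∷ b ∷ q) ≡ sortDesc (p ++ b ∷ a ∷ q)
sortDesc-swap []      a b q = Pointwise-≡⇒≡ (insert-swap a b (sortDesc q))
sortDesc-swap (c ∷ p) a b q = cong (insertDesc c) (sortDesc-swap p a b q)

length-sortDesc : ∀ s → length (sortDesc s) ≡ length s
length-sortDesc s = PermP.↭-length (sort-↭ s)

insertDesc-above : ∀ {a t} → All (a >_) t → insertDesc a t ≡ a ∷ t
insertDesc-above []        = refl
insertDesc-above (a>h ∷ _) = insertDesc-≥ _ (ℕP.<⇒≤ a>h)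

sortDesc-decreasing : ∀ {t} → Decreasing t → sortDesc t ≡ t
sortDesc-decreasing []                  = refl
sortDesc-decreasing {a ∷ t} (a>t ∷ t↘) =
  trans (cong (insertDesc a) (sortDesc-decreasing t↘)) (insertDesc-above a>t)

module _ {a} {A : Set a} where

  take-length-++ : ∀ (p r : List A) → take (length p) (p ++ r) ≡ p
  take-length-++ []      r = refl
  take-length-++ (x ∷ p) r = cong (x ∷_) (take-length-++ p r)

  drop-length-++ : ∀ (p r : List A) → drop (length p) (p ++ r) ≡ r
  drop-length-++ []      r = refl
  drop-length-++ (x ∷ p) r = drop-length-++ p r

  take-++-≥ : ∀ (p : List A) k r → take (length p ℕ.+ k) (p ++ r) ≡ p ++ take k r
  take-++-≥ []      k r = refl
  take-++-≥ (x ∷ p) k r = cong (x ∷_) (take-++-≥ p k r)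

  drop-++-≥ : ∀ (p : List A) k r → drop (length p ℕ.+ k) (p ++ r) ≡ drop k r
  drop-++-≥ []      k r = refl
  drop-++-≥ (x ∷ p) k r = drop-++-≥ p k r

  take-++-≤ : ∀ k (p r : List A) → k ≤ length p → take k (p ++ r) ≡ take k p
  take-++-≤ zero    p       r _         = refl
  take-++-≤ (suc k) (x ∷ p) r (s≤s k≤p) = cong (x ∷_) (take-++-≤ k p r k≤p)

  drop-++-≤ : ∀ k (p r : List A) → k ≤ length p → drop k (p ++ r) ≡ drop k p ++ r
  drop-++-≤ zero    p       r _         = refl
  drop-++-≤ (suc k) (x ∷ p) r (s≤s k≤p) = drop-++-≤ k p r k≤p

alternant : List ℕ → List ℕ → Sign
alternant t s with ListP.≡-dec ℕP._≟_ (sortDesc s) (sortDesc t)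
... | yes _ = listSign s
... | no  _ = nul

alternant-swap : ∀ t p a b q → alternant t (p ++ a ∷ b ∷ q) ≡ opposite (alternant t (p ++ b ∷ a ∷ q))
alternant-swap t p a b q
  with ListP.≡-dec ℕP._≟_ (sortDesc (p ++ a ∷ b ∷ q)) (sortDesc t)
     | ListP.≡-dec ℕP._≟_ (sortDesc (p ++ b ∷ a ∷ q)) (sortDesc t)
... | yes _  | yes _  = listSign-swap p a b q
... | no  _  | no  _  = refl
... | yes e  | no ¬e  = ⊥-elim (¬e (trans (sym (sortDesc-swap p a b q)) e))
... | no ¬e  | yes e  = ⊥-elim (¬e (trans (sortDesc-swap p a b q) e))

alternant-length : ∀ t s → alternant t s ≢ nul → length s ≡ length t
alternant-length t s ≢nul with ListP.≡-dec ℕP._≟_ (sortDesc s) (sortDesc t)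
... | yes e = begin
  length s            ≡⟨ sym (length-sortDesc s) ⟩
  length (sortDesc s) ≡⟨ cong length e ⟩
  length (sortDesc t) ≡⟨ length-sortDesc t ⟩
  length t            ∎
  where open ≡-Reasoning
... | no _ = ⊥-elim (≢nul refl)

alternant-≤ₗ : ∀ t s → Decreasing t → alternant t s ≢ nul → s ≤ₗ t
alternant-≤ₗ t s t↘ ≢nul with ListP.≡-dec ℕP._≟_ (sortDesc s) (sortDesc t)
... | yes e = subst (s ≤ₗ_) (trans e (sortDesc-decreasing t↘)) (≤ₗ-sortDesc s)
... | no _  = ⊥-elim (≢nul refl)

alternant-self : ∀ t → Decreasing t → alternant t t ≡ pos
alternant-self t t↘ with ListP.≡-dec ℕP._≟_ (sortDesc t) (sortDesc t)
... | yes _ = listSign-decreasing t↘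
... | no ¬e = ⊥-elim (¬e refl)

blockAlternant : List (List ℕ) → List ℕ → Sign
blockAlternant []       []      = pos
blockAlternant []       (_ ∷ _) = nul
blockAlternant (t ∷ ts) s       = alternant t (take (length t) s) ⊙ blockAlternant ts (drop (length t) s)

blockAlternant-self : ∀ ts → All Decreasing ts → blockAlternant ts (concat ts) ≡ pos
blockAlternant-self []       []          = refl
blockAlternant-self (t ∷ ts) (t↘ ∷ ts↘)
  rewrite take-length-++ t (concat ts) | drop-length-++ t (concat ts) | alternant-self t t↘ =
  blockAlternant-self ts ts↘

blockAlternant-length : ∀ ts s → blockAlternant ts s ≢ nul → length s ≡ length (concat ts)
blockAlternant-length []       []      _     = refl
blockAlternant-length []       (_ ∷ _) ≢nul  = ⊥-elim (≢nul refl)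
blockAlternant-length (t ∷ ts) s       ≢nul  = begin
  length s                                             ≡⟨ cong length (sym (ListP.take++drop≡id (length t) s)) ⟩
  length (take (length t) s ++ drop (length t) s)      ≡⟨ ListP.length-++ (take (length t) s) ⟩
  length (take (length t) s) ℕ.+ length (drop (length t) s)
    ≡⟨ cong₂ ℕ._+_ (alternant-length t (take (length t) s) ≢nul₁) (blockAlternant-length ts (drop (length t) s) ≢nul₂) ⟩
  length t ℕ.+ length (concat ts)                      ≡⟨ sym (ListP.length-++ t) ⟩
  length (t ++ concat ts)                              ∎
  where
  open ≡-Reasoning
  ≢nul₁ = ⊙-nonzeroˡ (alternant t (take (length t) s)) (blockAlternant ts (drop (length t) s)) ≢nul
  ≢nul₂ = ⊙-nonzeroʳ (alternant t (take (length t) s)) (blockAlternant ts (drop (length t) s)) ≢nul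

blockAlternant-≤ₗ : ∀ ts s → All Decreasing ts → blockAlternant ts s ≢ nul → s ≤ₗ concat ts
blockAlternant-≤ₗ []       []      _           _    = base _
blockAlternant-≤ₗ []       (_ ∷ _) _           ≢nul = ⊥-elim (≢nul refl)
blockAlternant-≤ₗ (t ∷ ts) s       (t↘ ∷ ts↘) ≢nul =
  subst (_≤ₗ t ++ concat ts) (ListP.take++drop≡id (length t) s)
    (≤ₗ-++ (alternant-length t (take (length t) s) ≢nul₁) (alternant-≤ₗ t (take (length t) s) t↘ ≢nul₁)
           (blockAlternant-≤ₗ ts (drop (length t) s) ts↘ ≢nul₂))
  where
  ≢nul₁ = ⊙-nonzeroˡ (alternant t (take (length t) s)) (blockAlternant ts (drop (length t) s)) ≢nul
  ≢nul₂ = ⊙-nonzeroʳ (alternant t (take (length t) s)) (blockAlternant ts (drop (length t) s)) ≢nul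

blockAlternant-nul : ∀ ts s → length s ≢ length (concat ts) → blockAlternant ts s ≡ nul
blockAlternant-nul ts s s≢ts with nul? (blockAlternant ts s)
... | inj₁ ≡nul = ≡nul
... | inj₂ ≢nul = ⊥-elim (s≢ts (blockAlternant-length ts s ≢nul))

data AdjacentInBlock : List (List ℕ) → ℕ → Set where
  here  : ∀ {t ts p} → suc p < length t → AdjacentInBlock (t ∷ ts) p
  there : ∀ {t ts p} → AdjacentInBlock ts p → AdjacentInBlock (t ∷ ts) (length t ℕ.+ p)

blockAlternant-swap : ∀ {ts k} → AdjacentInBlock ts k → ∀ p a b q → length p ≡ k →
  blockAlternant ts (p ++ a ∷ b ∷ q) ≡ opposite (blockAlternant ts (p ++ b ∷ a ∷ q))
blockAlternant-swap {t ∷ ts} (here p+1<t) p a b q refl =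
  let m , p+2+m≡t = ℕP.m≤n⇒∃[o]m+o≡n p+1<t in
  swapInside m (trans (sym p+2+m≡t) (sym (trans (ℕP.+-suc (length p) (suc m)) (cong suc (ℕP.+-suc (length p) m)))))
  where
  swapInside : ∀ m → length t ≡ length p ℕ.+ suc (suc m) →
    blockAlternant (t ∷ ts) (p ++ a ∷ b ∷ q) ≡ opposite (blockAlternant (t ∷ ts) (p ++ b ∷ a ∷ q))
  swapInside m t≡ = begin
    alternant t (take (length t) (p ++ a ∷ b ∷ q)) ⊙ blockAlternant ts (drop (length t) (p ++ a ∷ b ∷ q))
      ≡⟨ cong₂ _⊙_ (cong (alternant t) (takeBlock a b)) (cong (blockAlternant ts) (dropBlock a b)) ⟩
    alternant t (p ++ a ∷ b ∷ take m q) ⊙ blockAlternant ts (drop m q)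
      ≡⟨ cong (_⊙ blockAlternant ts (drop m q)) (alternant-swap t p a b (take m q)) ⟩
    opposite (alternant t (p ++ b ∷ a ∷ take m q)) ⊙ blockAlternant ts (drop m q)
      ≡⟨ opposite-⊙ˡ (alternant t (p ++ b ∷ a ∷ take m q)) (blockAlternant ts (drop m q)) ⟩
    opposite (alternant t (p ++ b ∷ a ∷ take m q) ⊙ blockAlternant ts (drop m q))
      ≡⟨ cong opposite (sym (cong₂ _⊙_ (cong (alternant t) (takeBlock b a)) (cong (blockAlternant ts) (dropBlock b a)))) ⟩
    opposite (alternant t (take (length t) (p ++ b ∷ a ∷ q)) ⊙ blockAlternant ts (drop (length t) (p ++ b ∷ a ∷ q))) ∎
    where
    open ≡-Reasoning
    takeBlock : ∀ x y → take (length t) (p ++ x ∷ y ∷ q) ≡ p ++ x ∷ y ∷ take m q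
    takeBlock x y = trans (cong (λ k → take k (p ++ x ∷ y ∷ q)) t≡) (take-++-≥ p (suc (suc m)) (x ∷ y ∷ q))
    dropBlock : ∀ x y → drop (length t) (p ++ x ∷ y ∷ q) ≡ drop m q
    dropBlock x y = trans (cong (λ k → drop k (p ++ x ∷ y ∷ q)) t≡) (drop-++-≥ p (suc (suc m)) (x ∷ y ∷ q))
blockAlternant-swap {t ∷ ts} (there {p = k} adj) p a b q p≡t+k =
  swapAfter (subst (length t ≤_) (sym p≡t+k) (ℕP.m≤m+n (length t) k))
  where
  p′≡k : length (drop (length t) p) ≡ k
  p′≡k = trans (ListP.length-drop (length t) p) (trans (cong (_∸ length t) p≡t+k) (ℕP.m+n∸m≡n (length t) k))
  swapAfter : length t ≤ length p →
    blockAlternant (t ∷ ts) (p ++ a ∷ b ∷ q) ≡ opposite (blockAlternant (t ∷ ts) (p ++ b ∷ a ∷ q))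
  swapAfter t≤p
    rewrite take-++-≤ (length t) p (a ∷ b ∷ q) t≤p | take-++-≤ (length t) p (b ∷ a ∷ q) t≤p
          | drop-++-≤ (length t) p (a ∷ b ∷ q) t≤p | drop-++-≤ (length t) p (b ∷ a ∷ q) t≤p =
    trans (cong (alternant t (take (length t) p) ⊙_) (blockAlternant-swap adj (drop (length t) p) a b q p′≡k))
          (opposite-⊙ʳ (alternant t (take (length t) p)) (blockAlternant ts (drop (length t) p ++ b ∷ a ∷ q)))

module Runs {X : Set} {ℓ} (key : X → ℕ) {J : X → X → Set ℓ} (J? : ∀ x y → Dec (J x y)) where

  extend : ℕ → List (List ℕ) → List (List ℕ)
  extend x []       = (x ∷ []) ∷ []
  extend x (t ∷ ts) = (x ∷ t) ∷ ts

  runs : List X → List (List ℕ)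
  runs []          = []
  runs (c ∷ [])    = (key c ∷ []) ∷ []
  runs (c ∷ d ∷ w) =
    if does (J? c d) then extend (key c) (runs (d ∷ w)) else (key c ∷ []) ∷ runs (d ∷ w)

  concat-extend : ∀ x bs → concat (extend x bs) ≡ x ∷ concat bs
  concat-extend x []       = refl
  concat-extend x (t ∷ ts) = refl

  concat-runs : ∀ w → concat (runs w) ≡ map key w
  concat-runs []          = refl
  concat-runs (c ∷ [])    = refl
  concat-runs (c ∷ d ∷ w) with J? c d | concat-runs (d ∷ w)
  ... | yes _ | ih = trans (concat-extend (key c) (runs (d ∷ w))) (cong (key c ∷_) ih)
  ... | no  _ | ih = cong (key c ∷_) ih

  length-concat-runs : ∀ w → length (concat (runs w)) ≡ length w
  length-concat-runs w = trans (cong length (concat-runs w)) (ListP.length-map key w)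

  runs-head : ∀ c w → ∃ λ t → ∃ λ ts → runs (c ∷ w) ≡ (key c ∷ t) ∷ ts
  runs-head c []      = [] , [] , refl
  runs-head c (d ∷ w) with J? c d | runs-head d w
  ... | yes _ | t , ts , eq rewrite eq = key d ∷ t , ts , refl
  ... | no  _ | _ = [] , runs (d ∷ w) , refl

  extend-adjacent : ∀ x {bs p} → AdjacentInBlock bs p → AdjacentInBlock (extend x bs) (suc p)
  extend-adjacent x (here p+1<t) = here (s≤s p+1<t)
  extend-adjacent x (there adj)  = there adj

  runs-adjacent : ∀ pre a b post → J a b → AdjacentInBlock (runs (pre ++ a ∷ b ∷ post)) (length pre)
  runs-adjacent [] a b post Jab with J? a b | runs-head b post
  ... | yes _   | t , ts , eq rewrite eq = here (s≤s (s≤s z≤n))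
  ... | no ¬Jab | _ = ⊥-elim (¬Jab Jab)
  runs-adjacent (c ∷ []) a b post Jab with J? c a | runs-adjacent [] a b post Jab
  ... | yes _ | adj = extend-adjacent (key c) adj
  ... | no  _ | adj = there adj
  runs-adjacent (c ∷ d ∷ pre) a b post Jab with J? c d | runs-adjacent (d ∷ pre) a b post Jab
  ... | yes _ | adj = extend-adjacent (key c) adj
  ... | no  _ | adj = there adj

  runs-decreasing : ∀ w → Linked (λ c d → J c d → key c > key d) w → All Decreasing (runs w)
  runs-decreasing []          _ = []
  runs-decreasing (c ∷ [])    _ = ([] ∷ []) ∷ []
  runs-decreasing (c ∷ d ∷ w) (Jcd⇒c>d ∷ linked) with J? c d | runs-head d w | runs-decreasing (d ∷ w) linked
  ... | no  _   | _ | ↘s = ([] ∷ []) ∷ ↘s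
  ... | yes Jcd | t , ts , eq | ↘s rewrite eq with ↘s
  ...   | (d>t ∷ t↘) ∷ ↘ts =
    ((c>d ∷ All.map (λ d>x → ℕP.<-trans d>x c>d) d>t) ∷ (d>t ∷ t↘)) ∷ ↘ts
    where c>d = Jcd⇒c>d Jcd

module _ {a} {A : Set a} where

  All-swap : ∀ {p} {P : A → Set p} xs x y ys → All P (xs ++ x ∷ y ∷ ys) → All P (xs ++ y ∷ x ∷ ys)
  All-swap []       x y ys (px ∷ py ∷ pys) = py ∷ px ∷ pys
  All-swap (z ∷ xs) x y ys (pz ∷ pxs)      = pz ∷ All-swap xs x y ys pxs

  Unique-swap : ∀ xs x y ys → Unique (xs ++ x ∷ y ∷ ys) → Unique (xs ++ y ∷ x ∷ ys)
  Unique-swap []       x y ys ((x≢y ∷ x∉ys) ∷ (y∉ys ∷ u)) = ((λ y≡x → x≢y (sym y≡x)) ∷ y∉ys) ∷ (x∉ys ∷ u)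
  Unique-swap (z ∷ xs) x y ys (z∉ ∷ u) = All-swap xs x y ys z∉ ∷ Unique-swap xs x y ys u

  length-filter-swap : ∀ {p} {P : A → Set p} (P? : ∀ x → Dec (P x)) xs x y ys →
    length (filter P? (xs ++ x ∷ y ∷ ys)) ≡ length (filter P? (xs ++ y ∷ x ∷ ys))
  length-filter-swap P? (z ∷ xs) x y ys with does (P? z)
  ... | true  = cong suc (length-filter-swap P? xs x y ys)
  ... | false = length-filter-swap P? xs x y ys
  length-filter-swap P? [] x y ys with P? x | P? y
  ... | yes px | yes py rewrite filter-accept P? {xs = ys} py | filter-accept P? {xs = ys} px = refl
  ... | yes px | no ¬py rewrite filter-reject P? {xs = ys} ¬py | filter-accept P? {xs = ys} px = refl
  ... | no ¬px | yes py rewrite filter-accept P? {xs = ys} py | filter-reject P? {xs = ys} ¬px = refl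
  ... | no ¬px | no ¬py rewrite filter-reject P? {xs = ys} ¬py | filter-reject P? {xs = ys} ¬px = refl

noninversions : List ℕ → ℕ
noninversions []      = 0
noninversions (a ∷ s) = length (filter (a ℕP.<?_) s) ℕ.+ noninversions s

noninversions-swap : ∀ p {x y} q → x < y → noninversions (p ++ x ∷ y ∷ q) ≡ suc (noninversions (p ++ y ∷ x ∷ q))
noninversions-swap [] {x} {y} q x<y
  rewrite filter-accept (x ℕP.<?_) {xs = q} x<y | filter-reject (y ℕP.<?_) {xs = q} (ℕP.<-asym x<y) =
  cong suc (x∙yz≈y∙xz (length (filter (x ℕP.<?_) q)) (length (filter (y ℕP.<?_) q)) (noninversions q))
  where open import Algebra.Properties.CommutativeSemigroup ℕP.+-commutativeSemigroup using (x∙yz≈y∙xz)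
noninversions-swap (c ∷ p) q x<y =
  trans (cong₂ ℕ._+_ (length-filter-swap (c ℕP.<?_) p _ _ q) (noninversions-swap p q x<y))
        (ℕP.+-suc _ _)

module _ {a} {A : Set a} where

  toList-injective′ : ∀ {n} (u v : Vec A n) → toList u ≡ toList v → u ≡ v
  toList-injective′ u v eq = trans (sym (cast-is-id refl u)) (VecP.toList-injective refl u v eq)

  ++-injective : ∀ (p r : List A) {q s} → length p ≡ length r → p ++ q ≡ r ++ s → p ≡ r × q ≡ s
  ++-injective []      []      _   eq = refl , eq
  ++-injective (x ∷ p) (y ∷ r) len eq with refl , eq′ ← ListP.∷-injective eq =
    let p≡r , q≡s = ++-injective p r (ℕP.suc-injective len) eq′ in cong (x ∷_) p≡r , q≡s

  lookup-linked : ∀ {r} {R : A → A → Set r} {n} (v : Vec A n) →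
    (∀ i j → toℕ j ≡ suc (toℕ i) → R (lookup v i) (lookup v j)) → Linked R (toList v)
  lookup-linked []           _ = []
  lookup-linked (x ∷ [])     _ = [-]
  lookup-linked (x ∷ y ∷ v) R-adj =
    R-adj zero (suc zero) refl ∷ lookup-linked (y ∷ v) (λ i j j≡i+1 → R-adj (suc i) (suc j) (cong suc j≡i+1))

  linked-lookup : ∀ {r} {R : A → A → Set r} {n} (v : Vec A n) → Linked R (toList v) →
    ∀ i j → toℕ j ≡ suc (toℕ i) → R (lookup v i) (lookup v j)
  linked-lookup (x ∷ y ∷ v) (Rxy ∷ _) zero    (suc zero)    _        = Rxy
  linked-lookup (x ∷ y ∷ v) (_ ∷ rs)  (suc i) (suc j)       j≡i+1    = linked-lookup (y ∷ v) rs i j (ℕP.suc-injective j≡i+1)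
  linked-lookup (x ∷ v)     _         zero    (suc (suc j)) ()
  linked-lookup (x ∷ v)     _         i       zero          ()

  replaceAdjacent : ∀ {n} (v : Vec A n) pre {x y} post → toList v ≡ pre ++ x ∷ y ∷ post →
    (x′ y′ : A) → Σ (Vec A n) λ v′ → toList v′ ≡ pre ++ x′ ∷ y′ ∷ post
  replaceAdjacent (_ ∷ _ ∷ v) [] post eq x′ y′ =
    x′ ∷ y′ ∷ v , cong (λ r → x′ ∷ y′ ∷ r) (ListP.∷-injectiveʳ (ListP.∷-injectiveʳ eq))
  replaceAdjacent (z ∷ v) (c ∷ pre) post eq x′ y′ =
    let v′ , eq′ = replaceAdjacent v pre post (ListP.∷-injectiveʳ eq) x′ y′
    in z ∷ v′ , cong₂ _∷_ (ListP.∷-injectiveˡ eq) eq′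
  replaceAdjacent []          []      post () x′ y′
  replaceAdjacent (_ ∷ [])    []      post () x′ y′
  replaceAdjacent []          (_ ∷ _) post () x′ y′

  splitAdjacent : ∀ (w : List A) k → k ℕ.+ 2 ≤ length w →
    ∃ λ pre → ∃ λ x → ∃ λ y → ∃ λ post → w ≡ pre ++ x ∷ y ∷ post × length pre ≡ k
  splitAdjacent (x ∷ y ∷ w) zero    _ = [] , x , y , w , refl , refl
  splitAdjacent (x ∷ [])    zero    (s≤s ())
  splitAdjacent (z ∷ w)     (suc k) (s≤s k+2≤w) =
    let pre , x , y , post , eq , len = splitAdjacent w k k+2≤w
    in z ∷ pre , x , y , post , cong (z ∷_) eq , cong suc len

  firstAdjacent : ∀ {q} {Q : A → A → Set q} → (∀ x y → Dec (Q x y)) → ∀ w →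
    (∃ λ pre → ∃ λ x → ∃ λ y → ∃ λ post → w ≡ pre ++ x ∷ y ∷ post × Q x y) ⊎ Linked (λ x y → ¬ Q x y) w
  firstAdjacent Q? []          = inj₂ []
  firstAdjacent Q? (x ∷ [])    = inj₂ [-]
  firstAdjacent Q? (x ∷ y ∷ w) with Q? x y | firstAdjacent Q? (y ∷ w)
  ... | yes Qxy | _ = inj₁ ([] , x , y , w , refl , Qxy)
  ... | no ¬Qxy | inj₁ (pre , x′ , y′ , post , eq , Qx′y′) = inj₁ (x ∷ pre , x′ , y′ , post , cong (x ∷_) eq , Qx′y′)
  ... | no ¬Qxy | inj₂ linked = inj₂ (¬Qxy ∷ linked)

module _ {a b r} {A : Set a} {B : Set b} {_≼_ : B → B → Set r}
         (≼-trans : ∀ {x y z} → x ≼ y → y ≼ z → x ≼ z) (≼-total : ∀ x y → x ≼ y ⊎ y ≼ x) (f : A → B) where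

  extractMinimum : ∀ x xs → ∃ λ ys → ∃ λ m → ∃ λ zs → x ∷ xs ≡ ys ++ m ∷ zs × All (λ z → f m ≼ f z) (ys ++ zs)
  extractMinimum x []       = [] , x , [] , refl , []
  extractMinimum x (y ∷ xs) with extractMinimum y xs
  ... | ys , m , zs , eq , m-min with ≼-total (f x) (f m)
  ...   | inj₁ x≼m = [] , x , y ∷ xs , refl , subst (All (λ z → f x ≼ f z)) (sym eq)
                       (AllP.++⁺ (All.map (≼-trans x≼m) (AllP.++⁻ˡ ys m-min))
                                 (x≼m ∷ All.map (≼-trans x≼m) (AllP.++⁻ʳ ys m-min)))
  ...   | inj₂ m≼x = x ∷ ys , m , zs , cong (x ∷_) eq , m≼x ∷ m-min

module _ {a b} {A : Set a} {B : Set b} (f : A → B) where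

  Unique-remove : ∀ xs x ys → Unique (map f (xs ++ x ∷ ys)) →
    All (λ y → f y ≢ f x) (xs ++ ys) × Unique (map f (xs ++ ys))
  Unique-remove []       x ys (x∉ys ∷ u) = All.map (λ fx≢fy fy≡fx → fx≢fy (sym fy≡fx)) (AllP.map⁻ x∉ys) , u
  Unique-remove (z ∷ xs) x ys (z∉ ∷ u) with Unique-remove xs x ys u | AllP.++⁻ xs (AllP.map⁻ {xs = xs ++ x ∷ ys} z∉)
  ... | others , u′ | z∉xs , (fz≢fx ∷ z∉ys) = fz≢fx ∷ others , AllP.map⁺ (AllP.++⁺ z∉xs z∉ys) ∷ u′


module _ {a b} {A : Set a} {B : Set b} (g : A → B) where

  All-map-toList⁺ : ∀ {p} {P : B → Set p} {m} (v : Vec A m) → (∀ k → P (g (lookup v k))) → All P (map g (toList v))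
  All-map-toList⁺ []      _  = []
  All-map-toList⁺ (x ∷ v) Pv = Pv zero ∷ All-map-toList⁺ v (λ k → Pv (suc k))

  All-map-toList⁻ : ∀ {p} {P : B → Set p} {m} (v : Vec A m) → All P (map g (toList v)) → ∀ k → P (g (lookup v k))
  All-map-toList⁻ (x ∷ v) (px ∷ _)  zero    = px
  All-map-toList⁻ (x ∷ v) (_  ∷ pv) (suc k) = All-map-toList⁻ v pv k

  Unique-map-toList⁺ : ∀ {m} (v : Vec A m) → (∀ i j → g (lookup v i) ≡ g (lookup v j) → i ≡ j) → Unique (map g (toList v))
  Unique-map-toList⁺ []      _         = []
  Unique-map-toList⁺ (x ∷ v) injective =
    All-map-toList⁺ v (λ k same → FinP.0≢1+n (injective zero (suc k) same)) ∷
    Unique-map-toList⁺ v (λ i j same → FinP.suc-injective (injective (suc i) (suc j) same))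

  Unique-map-toList⁻ : ∀ {m} (v : Vec A m) → Unique (map g (toList v)) → ∀ i j → g (lookup v i) ≡ g (lookup v j) → i ≡ j
  Unique-map-toList⁻ (x ∷ v) _            zero    zero    _    = refl
  Unique-map-toList⁻ (x ∷ v) (x∉v ∷ _)    zero    (suc j) same = ⊥-elim (All-map-toList⁻ v x∉v j same)
  Unique-map-toList⁻ (x ∷ v) (x∉v ∷ _)    (suc i) zero    same = ⊥-elim (All-map-toList⁻ v x∉v i (sym same))
  Unique-map-toList⁻ (x ∷ v) (_   ∷ u)    (suc i) (suc j) same = cong suc (Unique-map-toList⁻ v u i j same)

  length-filter-map : ∀ {p} {P : B → Set p} (P? : ∀ x → Dec (P x)) w →
    length (filter (λ x → P? (g x)) w) ≡ length (filter P? (map g w))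
  length-filter-map P? []      = refl
  length-filter-map P? (x ∷ w) with P? (g x)
  ... | yes _ = cong suc (length-filter-map P? w)
  ... | no  _ = length-filter-map P? w

  SameOrSwapped : A → A → A → A → Set b
  SameOrSwapped x y x′ y′ = (g x′ ≡ g x × g y′ ≡ g y) ⊎ (g x′ ≡ g y × g y′ ≡ g x)

  map-adjacent-move : ∀ {p} (P : List B → Set p) → (∀ xs x y ys → P (xs ++ x ∷ y ∷ ys) → P (xs ++ y ∷ x ∷ ys)) →
    ∀ pre post {x y x′ y′} → SameOrSwapped x y x′ y′ →
    P (map g (pre ++ x ∷ y ∷ post)) → P (map g (pre ++ x′ ∷ y′ ∷ post))
  map-adjacent-move P P-swap pre post {x} {y} {x′} {y′} moved Pw
    rewrite ListP.map-++ g pre (x ∷ y ∷ post) | ListP.map-++ g pre (x′ ∷ y′ ∷ post) with moved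
  ... | inj₁ (x′≡x , y′≡y) rewrite x′≡x | y′≡y = Pw
  ... | inj₂ (x′≡y , y′≡x) rewrite x′≡y | y′≡x = P-swap (map g pre) (g x) (g y) (map g post) Pw

module ColoredWords (n : ℕ) where

  letterℕ : Letter n → ℕ
  letterℕ a = toℕ (letter a)

  AscentPair : Letter n → Letter n → Set
  AscentPair a b = letterℕ a < letterℕ b × color a ≤ color b

  ascentPair? : ∀ a b → Dec (AscentPair a b)
  ascentPair? a b = (letterℕ a ℕP.<? letterℕ b) ×-dec (color a ℕP.≤? color b)

  descent? : ∀ a b → Dec (letterℕ a > letterℕ b)
  descent? a b = letterℕ b ℕP.<? letterℕ a

  module ByLetter = Runs letterℕ descent?
  module ByColor  = Runs color (λ a b → ¬? (descent? a b))

  letterSign colorSign : Word n → List ℕ → Sign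
  letterSign t = blockAlternant (ByLetter.runs t)
  colorSign  t = blockAlternant (ByColor.runs t)

  sign : Word n → Word n → Sign
  sign t w = letterSign t (map letterℕ w) ⊙ colorSign t (map color w)

  sign-++ : ∀ t u v x y → sign t (u ++ x ∷ y ∷ v) ≡
    letterSign t (map letterℕ u ++ letterℕ x ∷ letterℕ y ∷ map letterℕ v) ⊙
    colorSign t (map color u ++ color x ∷ color y ∷ map color v)
  sign-++ t u v x y = cong₂ (λ ls cs → letterSign t ls ⊙ colorSign t cs) (ListP.map-++ letterℕ u _) (ListP.map-++ color u _)

  Alternating : (List ℕ → Sign) → List ℕ → List ℕ → Set
  Alternating g p q = ∀ a b → g (p ++ a ∷ b ∷ q) ≡ opposite (g (p ++ b ∷ a ∷ q))

  -- Every adjacent pair of t lies in a letter block or in a color block.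
  letterSign-or-colorSign-alternating : ∀ t u v →
    Alternating (letterSign t) (map letterℕ u) (map letterℕ v) ⊎ Alternating (colorSign t) (map color u) (map color v)
  letterSign-or-colorSign-alternating t u v with length u ℕ.+ suc (suc (length v)) ℕP.≟ length t
  ... | no ≢t = inj₁ λ a b → trans (nulAt a b) (cong opposite (sym (nulAt b a)))
    where
    nulAt : ∀ a b → letterSign t (map letterℕ u ++ a ∷ b ∷ map letterℕ v) ≡ nul
    nulAt a b = blockAlternant-nul (ByLetter.runs t) _ λ ≡t → ≢t (begin
      length u ℕ.+ suc (suc (length v))
        ≡⟨ cong₂ (λ p q → p ℕ.+ suc (suc q)) (ListP.length-map letterℕ u) (ListP.length-map letterℕ v) ⟨
      length (map letterℕ u) ℕ.+ suc (suc (length (map letterℕ v)))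
        ≡⟨ ListP.length-++ (map letterℕ u) ⟨
      length (map letterℕ u ++ a ∷ b ∷ map letterℕ v)    ≡⟨ ≡t ⟩
      length (concat (ByLetter.runs t))                   ≡⟨ ByLetter.length-concat-runs t ⟩
      length t                                            ∎)
      where open ≡-Reasoning
  ... | yes ≡t with splitAdjacent t (length u) (subst (length u ℕ.+ 2 ≤_) ≡t (ℕP.+-monoʳ-≤ (length u) (s≤s (s≤s z≤n))))
  ...   | pre , x , y , post , refl , pre≡u with descent? x y
  ...     | yes x>y = inj₁ λ a b → blockAlternant-swap (ByLetter.runs-adjacent pre x y post x>y) (map letterℕ u) a b (map letterℕ v)
                                      (trans (ListP.length-map letterℕ u) (sym pre≡u))
  ...     | no  x≯y = inj₂ λ a b → blockAlternant-swap (ByColor.runs-adjacent pre x y post x≯y) (map color u) a b (map color v)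
                                      (trans (ListP.length-map color u) (sym pre≡u))

  lettersFall : ∀ w → Linked (λ c d → letterℕ c > letterℕ d → letterℕ c > letterℕ d) w
  lettersFall []          = []
  lettersFall (c ∷ [])    = [-]
  lettersFall (c ∷ d ∷ w) = (λ c>d → c>d) ∷ lettersFall (d ∷ w)

  ColorsFall : Word n → Set
  ColorsFall = Linked (λ c d → ¬ letterℕ c > letterℕ d → color c > color d)

  sign-self : ∀ t → ColorsFall t → sign t t ≡ pos
  sign-self t colorsFall = cong₂ _⊙_
    (subst (λ s → blockAlternant (ByLetter.runs t) s ≡ pos) (ByLetter.concat-runs t)
      (blockAlternant-self (ByLetter.runs t) (ByLetter.runs-decreasing t (lettersFall t))))
    (subst (λ s → blockAlternant (ByColor.runs t) s ≡ pos) (ByColor.concat-runs t)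
      (blockAlternant-self (ByColor.runs t) (ByColor.runs-decreasing t colorsFall)))

  key : Word n → List ℕ
  key w = map letterℕ w ++ map color w

  letters-colors-injective : ∀ w w′ → map letterℕ w ≡ map letterℕ w′ → map color w ≡ map color w′ → w ≡ w′
  letters-colors-injective []      []        _  _  = refl
  letters-colors-injective (a ∷ w) (a′ ∷ w′) ls cs =
    cong₂ _∷_ (cong₂ _,_ (FinP.toℕ-injective (ListP.∷-injectiveˡ ls)) (ListP.∷-injectiveˡ cs))
              (letters-colors-injective w w′ (ListP.∷-injectiveʳ ls) (ListP.∷-injectiveʳ cs))

  key-injective : ∀ w w′ → length w ≡ length w′ → key w ≡ key w′ → w ≡ w′
  key-injective w w′ len eq =
    let ls , cs = ++-injective (map letterℕ w) (map letterℕ w′)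
                    (trans (ListP.length-map letterℕ w) (trans len (sym (ListP.length-map letterℕ w′)))) eq
    in letters-colors-injective w w′ ls cs

  sign-≤ₗ : ∀ t w → ColorsFall t → sign t w ≢ nul → key w ≤ₗ key t
  sign-≤ₗ t w colorsFall ≢nul =
    ≤ₗ-++ letters-length
      (subst (map letterℕ w ≤ₗ_) (ByLetter.concat-runs t)
        (blockAlternant-≤ₗ (ByLetter.runs t) _ (ByLetter.runs-decreasing t (lettersFall t)) ≢nulˡ))
      (subst (map color w ≤ₗ_) (ByColor.concat-runs t)
        (blockAlternant-≤ₗ (ByColor.runs t) _ (ByColor.runs-decreasing t colorsFall) ≢nulʳ))
    where
    ≢nulˡ = ⊙-nonzeroˡ (letterSign t (map letterℕ w)) (colorSign t (map color w)) ≢nul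
    ≢nulʳ = ⊙-nonzeroʳ (letterSign t (map letterℕ w)) (colorSign t (map color w)) ≢nul
    letters-length : length (map letterℕ w) ≡ length (map letterℕ t)
    letters-length = trans (blockAlternant-length (ByLetter.runs t) _ ≢nulˡ) (cong length (ByLetter.concat-runs t))

  ascentFree : ∀ (σ : CWord n) → ¬ Ascent σ → Linked (λ a b → ¬ AscentPair a b) (toList σ)
  ascentFree σ ¬asc = lookup-linked σ λ i j j≡i+1 asc → ¬asc (i , j , j≡i+1 , asc)

  ascentFree⇒¬Ascent : ∀ (σ : CWord n) → Linked (λ a b → ¬ AscentPair a b) (toList σ) → ¬ Ascent σ
  ascentFree⇒¬Ascent σ free (i , j , j≡i+1 , asc) = linked-lookup σ free i j j≡i+1 asc

  neighbours-distinct : ∀ (σ : CWord n) → IsColoredPerm σ → Linked (λ a b → letterℕ a ≢ letterℕ b) (toList σ)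
  neighbours-distinct σ perm = lookup-linked σ λ i j j≡i+1 same →
    ℕP.1+n≢n (trans (sym j≡i+1) (cong toℕ (sym (perm i j (FinP.toℕ-injective same)))))

  nonincreasing⇒colorsFall : ∀ (σ : CWord n) → IsColoredPerm σ → ¬ Ascent σ → ColorsFall (toList σ)
  nonincreasing⇒colorsFall σ perm ¬asc =
    Linked.zipWith fall (ascentFree σ ¬asc , neighbours-distinct σ perm)
    where
    fall : ∀ {c d} → ¬ AscentPair c d × letterℕ c ≢ letterℕ d → ¬ letterℕ c > letterℕ d → color c > color d
    fall (¬asc , c≢d) c≯d = ℕP.≰⇒> λ c≤d → ¬asc (ℕP.≤∧≢⇒< (ℕP.≮⇒≥ c≯d) c≢d , c≤d)

  disorder : Word n → ℕ
  disorder w = noninversions (map letterℕ w) ℕ.+ noninversions (map color w)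

  private
    noninversions-map : ∀ (g : Letter n → ℕ) pre x y post →
      noninversions (map g (pre ++ x ∷ y ∷ post)) ≡ noninversions (map g pre ++ g x ∷ g y ∷ map g post)
    noninversions-map g pre x y post = cong noninversions (ListP.map-++ g pre (x ∷ y ∷ post))

  disorder-swapLetters : ∀ pre post {x y} i j → toℕ x < toℕ y →
    disorder (pre ++ (y , i) ∷ (x , j) ∷ post) < disorder (pre ++ (x , i) ∷ (y , j) ∷ post)
  disorder-swapLetters pre post {x} {y} i j x<y
    rewrite noninversions-map letterℕ pre (y , i) (x , j) post | noninversions-map letterℕ pre (x , i) (y , j) post
          | noninversions-map color pre (y , i) (x , j) post | noninversions-map color pre (x , i) (y , j) post
          | noninversions-swap (map letterℕ pre) (map letterℕ post) x<y =
    ℕP.+-monoˡ-< (noninversions (map color pre ++ i ∷ j ∷ map color post)) (ℕP.n<1+n _)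

  disorder-swapBoth : ∀ pre post {x y i j} → toℕ x < toℕ y → i < j →
    disorder (pre ++ (y , j) ∷ (x , i) ∷ post) < disorder (pre ++ (x , i) ∷ (y , j) ∷ post)
  disorder-swapBoth pre post {x} {y} {i} {j} x<y i<j
    rewrite noninversions-map letterℕ pre (y , j) (x , i) post | noninversions-map letterℕ pre (x , i) (y , j) post
          | noninversions-map color pre (y , j) (x , i) post | noninversions-map color pre (x , i) (y , j) post
          | noninversions-swap (map letterℕ pre) (map letterℕ post) x<y
          | noninversions-swap (map color pre) (map color post) i<j =
    ℕP.+-mono-< (ℕP.n<1+n _) (ℕP.n<1+n _)

  disorder-swapColors : ∀ pre post x y {i j} → i < j →
    disorder (pre ++ (x , j) ∷ (y , i) ∷ post) < disorder (pre ++ (x , i) ∷ (y , j) ∷ post)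
  disorder-swapColors pre post x y {i} {j} i<j
    rewrite noninversions-map letterℕ pre (x , j) (y , i) post | noninversions-map letterℕ pre (x , i) (y , j) post
          | noninversions-map color pre (x , j) (y , i) post | noninversions-map color pre (x , i) (y , j) post
          | noninversions-swap (map color pre) (map color post) i<j =
    ℕP.+-monoʳ-< (noninversions (map letterℕ pre ++ toℕ x ∷ toℕ y ∷ map letterℕ post)) (ℕP.n<1+n _)

module FormalSums {c ℓ} (F : Field c ℓ) (n : ℕ) where
  open Field F renaming (refl to ≈-refl; sym to ≈-sym; trans to ≈-trans)
  open TensorAlgebra F n
  open import Relation.Binary.Reasoning.Setoid setoid
  open import Algebra.Properties.AbelianGroup +-abelianGroup using (⁻¹-∙-comm; ε⁻¹≈ε)
  open import Algebra.Properties.Group +-group using (x∙y⁻¹≈ε⇒x≈y; x≈y⇒x∙y⁻¹≈ε)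
  open import Algebra.Properties.Ring ring using (-‿distribˡ-*)

  negFS : FS → FS
  negFS = map (λ p → (- proj₁ p , proj₂ p))

  coeff-++ : ∀ w s t → coeff w (s ++ t) ≈ coeff w s + coeff w t
  coeff-++ w []            t = ≈-sym (+-identityˡ _)
  coeff-++ w ((a , u) ∷ s) t with u ≟W w
  ... | yes _ = ≈-trans (+-congˡ (coeff-++ w s t)) (≈-sym (+-assoc _ _ _))
  ... | no  _ = coeff-++ w s t

  coeff-neg : ∀ w s → coeff w (negFS s) ≈ - coeff w s
  coeff-neg w []            = ≈-sym ε⁻¹≈ε
  coeff-neg w ((a , u) ∷ s) with u ≟W w
  ... | yes _ = ≈-trans (+-congˡ (coeff-neg w s)) (⁻¹-∙-comm a (coeff w s))
  ... | no  _ = coeff-neg w s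

  ≋-sym : ∀ {s t} → s ≋ t → t ≋ s
  ≋-sym s≋t w = ≈-sym (s≋t w)

  ≋-trans : ∀ {s t u} → s ≋ t → t ≋ u → s ≋ u
  ≋-trans s≋t t≋u w = ≈-trans (s≋t w) (t≋u w)

  ≋-++ : ∀ {s s′ t t′} → s ≋ s′ → t ≋ t′ → (s ++ t) ≋ (s′ ++ t′)
  ≋-++ {s} {s′} {t} {t′} s≋s′ t≋t′ w = begin
    coeff w (s ++ t)          ≈⟨ coeff-++ w s t ⟩
    coeff w s + coeff w t     ≈⟨ +-cong (s≋s′ w) (t≋t′ w) ⟩
    coeff w s′ + coeff w t′   ≈⟨ coeff-++ w s′ t′ ⟨
    coeff w (s′ ++ t′)        ∎

  ≋-neg : ∀ {s t} → s ≋ t → negFS s ≋ negFS t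
  ≋-neg {s} {t} s≋t w = ≈-trans (coeff-neg w s) (≈-trans (-‿cong (s≋t w)) (≈-sym (coeff-neg w t)))

  coeff-− : ∀ w s t → coeff w (s − t) ≈ coeff w s + - coeff w t
  coeff-− w s t = ≈-trans (coeff-++ w s (negFS t)) (+-congˡ (coeff-neg w t))

  −-++ : ∀ s t u v → ((s − u) ++ (t − v)) ≋ ((s ++ t) − (u ++ v))
  −-++ s t u v w = begin
    coeff w ((s − u) ++ (t − v))
      ≈⟨ ≈-trans (coeff-++ w (s − u) (t − v)) (+-cong (coeff-− w s u) (coeff-− w t v)) ⟩
    (coeff w s + - coeff w u) + (coeff w t + - coeff w v)
      ≈⟨ interchange _ _ _ _ ⟩
    (coeff w s + coeff w t) + (- coeff w u + - coeff w v)
      ≈⟨ +-cong (coeff-++ w s t) (≈-trans (-‿cong (coeff-++ w u v)) (≈-sym (⁻¹-∙-comm _ _))) ⟨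
    coeff w (s ++ t) + - coeff w (u ++ v)
      ≈⟨ coeff-− w (s ++ t) (u ++ v) ⟨
    coeff w ((s ++ t) − (u ++ v))                         ∎
    where open import Algebra.Properties.CommutativeSemigroup +-commutativeSemigroup using (interchange)

  −-cancel : ∀ s t u → ((s ++ t) ++ negFS (t − u)) ≋ (s − negFS u)
  −-cancel s t u w = begin
    coeff w ((s ++ t) ++ negFS (t − u))                   ≈⟨ coeff-++ w (s ++ t) (negFS (t − u)) ⟩
    coeff w (s ++ t) + coeff w (negFS (t − u))
      ≈⟨ +-cong (coeff-++ w s t) (≈-trans (coeff-neg w (t − u)) (-‿cong (coeff-− w t u))) ⟩
    (coeff w s + coeff w t) + - (coeff w t + - coeff w u) ≈⟨ +-congˡ (⁻¹-∙-comm _ _) ⟨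
    (coeff w s + coeff w t) + (- coeff w t + - - coeff w u) ≈⟨ +-assoc _ _ _ ⟩
    coeff w s + (coeff w t + (- coeff w t + - - coeff w u))
      ≈⟨ +-congˡ (≈-trans (≈-sym (+-assoc _ _ _)) (≈-trans (+-congʳ (-‿inverseʳ _)) (+-identityˡ _))) ⟩
    coeff w s + - - coeff w u                              ≈⟨ +-congˡ (-‿cong (coeff-neg w u)) ⟨
    coeff w s + - coeff w (negFS u)                        ≈⟨ coeff-− w s (negFS u) ⟨
    coeff w (s − negFS u)                                  ∎

  data Pointwise≈ : FS → FS → Set (c ⊔ ℓ) where
    []  : Pointwise≈ [] []
    _∷_ : ∀ {a b u s t} → a ≈ b → Pointwise≈ s t → Pointwise≈ ((a , u) ∷ s) ((b , u) ∷ t)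

  Pointwise≈⇒≋ : ∀ {s t} → Pointwise≈ s t → s ≋ t
  Pointwise≈⇒≋ []                       w = ≈-refl
  Pointwise≈⇒≋ (_∷_ {u = u} a≈b s≈t) w with u ≟W w
  ... | yes _ = +-cong a≈b (Pointwise≈⇒≋ s≈t w)
  ... | no  _ = Pointwise≈⇒≋ s≈t w

  InI-resp : ∀ {s t} → s ≋ t → InI s → InI t
  InI-resp {s} {t} s≋t (ws , s≋ws) = ws , ≋-trans {t} {s} {expand ws} (≋-sym {s} {t} s≋t) s≋ws

  InI-++ : ∀ {s t} → InI s → InI t → InI (s ++ t)
  InI-++ {s} {t} (ws , s≋ws) (vs , t≋vs) =
    ws ++ vs , subst ((s ++ t) ≋_) (sym (ListP.concatMap-++ _ ws vs)) (≋-++ {s} {expand ws} {t} {expand vs} s≋ws t≋vs)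

  InI-neg : ∀ {s} → InI s → InI (negFS s)
  InI-neg {s} (ws , s≋ws) =
    map negateTerm ws , ≋-trans {negFS s} {negFS (expand ws)} {expand (map negateTerm ws)}
                                (≋-neg {s} {expand ws} s≋ws) (Pointwise≈⇒≋ (negFS-expand ws))
    where
    negateTerm : Carrier × Word n × Gen × Word n → Carrier × Word n × Gen × Word n
    negateTerm (a , u , g , v) = (- a , u , g , v)
    negFS-expand : ∀ ws → Pointwise≈ (negFS (expand ws)) (expand (map negateTerm ws))
    negFS-expand []                              = []
    negFS-expand ((a , u , rel₁ x y i   , v) ∷ ws) =
      -‿distribˡ-* a 1# ∷ -‿distribˡ-* a 1# ∷ negFS-expand ws
    negFS-expand ((a , u , rel₂ x y i j , v) ∷ ws) =
      -‿distribˡ-* a 1# ∷ -‿distribˡ-* a 1# ∷ -‿distribˡ-* a 1# ∷ -‿distribˡ-* a 1# ∷ negFS-expand ws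

  placed : Word n → Word n → Carrier × Word n → Carrier × Word n
  placed u v (b , w) = (b , u ++ w ++ v)

  relatorAt : Word n → Gen → Word n → FS
  relatorAt u g v = map (placed u v) (genFS g)

  InI-relatorAt : ∀ u g v → InI (relatorAt u g v)
  InI-relatorAt u g v = ((1# , u , g , v) ∷ []) , Pointwise≈⇒≋ (unit g)
    where
    1≈1*1 : 1# ≈ 1# * 1#
    1≈1*1 = ≈-sym (*-identityˡ 1#)
    unit : ∀ g → Pointwise≈ (relatorAt u g v) (expand ((1# , u , g , v) ∷ []))
    unit (rel₁ x y i)   = 1≈1*1 ∷ 1≈1*1 ∷ []
    unit (rel₂ x y i j) = 1≈1*1 ∷ 1≈1*1 ∷ 1≈1*1 ∷ 1≈1*1 ∷ []

  eval : (Word n → Carrier) → FS → Carrier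
  eval f []            = 0#
  eval f ((a , u) ∷ s) = a * f u + eval f s

  eval-++ : ∀ f s t → eval f (s ++ t) ≈ eval f s + eval f t
  eval-++ f []            t = ≈-sym (+-identityˡ _)
  eval-++ f ((a , u) ∷ s) t = ≈-trans (+-congˡ (eval-++ f s t)) (≈-sym (+-assoc _ _ _))

  eval-neg : ∀ f s → eval f (negFS s) ≈ - eval f s
  eval-neg f []            = ≈-sym ε⁻¹≈ε
  eval-neg f ((a , u) ∷ s) =
    ≈-trans (+-cong (≈-sym (-‿distribˡ-* a (f u))) (eval-neg f s)) (⁻¹-∙-comm (a * f u) (eval f s))

  remove : Word n → FS → FS
  remove u []            = []
  remove u ((b , v) ∷ s) with v ≟W u
  ... | yes _ = remove u s
  ... | no  _ = (b , v) ∷ remove u s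

  length-remove : ∀ u s → length (remove u s) ≤ length s
  length-remove u []            = z≤n
  length-remove u ((b , v) ∷ s) with v ≟W u
  ... | yes _ = ℕP.m≤n⇒m≤1+n (length-remove u s)
  ... | no  _ = s≤s (length-remove u s)

  coeff-remove-same : ∀ u s → coeff u (remove u s) ≈ 0#
  coeff-remove-same u []            = ≈-refl
  coeff-remove-same u ((b , v) ∷ s) with v ≟W u
  ... | yes _ = coeff-remove-same u s
  ... | no v≢u with v ≟W u
  ...   | yes v≡u = ⊥-elim (v≢u v≡u)
  ...   | no  _   = coeff-remove-same u s

  coeff-remove-other : ∀ u w s → u ≢ w → coeff w (remove u s) ≈ coeff w s
  coeff-remove-other u w []            _   = ≈-refl
  coeff-remove-other u w ((b , v) ∷ s) u≢w with v ≟W u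
  ... | yes refl with v ≟W w
  ...   | yes u≡w = ⊥-elim (u≢w u≡w)
  ...   | no  _   = coeff-remove-other u w s u≢w
  coeff-remove-other u w ((b , v) ∷ s) u≢w | no _ with v ≟W w
  ...   | yes _ = +-congˡ (coeff-remove-other u w s u≢w)
  ...   | no  _ = coeff-remove-other u w s u≢w

  eval-remove : ∀ f u s → eval f s ≈ coeff u s * f u + eval f (remove u s)
  eval-remove f u []            = ≈-sym (≈-trans (+-identityʳ _) (zeroˡ (f u)))
  eval-remove f u ((b , v) ∷ s) with v ≟W u
  ... | yes refl = begin
    b * f v + eval f s                                  ≈⟨ +-congˡ (eval-remove f v s) ⟩
    b * f v + (coeff v s * f v + eval f (remove v s))   ≈⟨ +-assoc _ _ _ ⟨
    (b * f v + coeff v s * f v) + eval f (remove v s)   ≈⟨ +-congʳ (distribʳ (f v) b (coeff v s)) ⟨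
    (b + coeff v s) * f v + eval f (remove v s)         ∎
  ... | no _ = begin
    b * f v + eval f s                                  ≈⟨ +-congˡ (eval-remove f u s) ⟩
    b * f v + (coeff u s * f u + eval f (remove u s))   ≈⟨ x∙yz≈y∙xz _ _ _ ⟩
    coeff u s * f u + (b * f v + eval f (remove u s))   ∎
    where open import Algebra.Properties.CommutativeSemigroup +-commutativeSemigroup using (x∙yz≈y∙xz)

  -- The bound k makes the recursion through remove structural.
  eval-null : ∀ f k s → length s ≤ k → (∀ w → coeff w s ≈ 0#) → eval f s ≈ 0#
  eval-null f k       []            _         _     = ≈-refl
  eval-null f (suc k) ((a , u) ∷ s) (s≤s s≤k) null = begin
    a * f u + eval f s                                 ≈⟨ +-congˡ (eval-remove f u s) ⟩
    a * f u + (coeff u s * f u + eval f (remove u s))  ≈⟨ +-assoc _ _ _ ⟨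
    (a * f u + coeff u s * f u) + eval f (remove u s)  ≈⟨ +-congʳ (distribʳ (f u) a (coeff u s)) ⟨
    (a + coeff u s) * f u + eval f (remove u s)        ≈⟨ +-cong (≈-trans (*-congʳ null-u) (zeroˡ (f u))) null-rest ⟩
    0# + 0#                                            ≈⟨ +-identityʳ 0# ⟩
    0#                                                 ∎
    where
    null-u : a + coeff u s ≈ 0#
    null-u with null u
    ... | h with u ≟W u
    ...   | yes _ = h
    ...   | no u≢u = ⊥-elim (u≢u refl)
    null-other : ∀ {w} → u ≢ w → coeff w s ≈ 0#
    null-other {w} u≢w with null w
    ... | h with u ≟W w
    ...   | yes u≡w = ⊥-elim (u≢w u≡w)
    ...   | no  _   = h
    null-remove : ∀ w → coeff w (remove u s) ≈ 0#
    null-remove w with u ≟W w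
    ... | yes refl = coeff-remove-same u s
    ... | no u≢w   = ≈-trans (coeff-remove-other u w s u≢w) (null-other u≢w)
    null-rest : eval f (remove u s) ≈ 0#
    null-rest = eval-null f k (remove u s) (ℕP.≤-trans (length-remove u s) s≤k) null-remove

  eval-resp-≋ : ∀ f {s t} → s ≋ t → eval f s ≈ eval f t
  eval-resp-≋ f {s} {t} s≋t = x∙y⁻¹≈ε⇒x≈y (eval f s) (eval f t) (begin
    eval f s + - eval f t          ≈⟨ +-congˡ (eval-neg f t) ⟨
    eval f s + eval f (negFS t)    ≈⟨ eval-++ f s (negFS t) ⟨
    eval f (s ++ negFS t)          ≈⟨ eval-null f _ (s ++ negFS t) ℕP.≤-refl null ⟩
    0#                             ∎)
    where
    null : ∀ w → coeff w (s ++ negFS t) ≈ 0#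
    null w = ≈-trans (coeff-++ w s (negFS t)) (≈-trans (+-congˡ (coeff-neg w t)) (x≈y⇒x∙y⁻¹≈ε (s≋t w)))

  VanishesOnRelators : (Word n → Carrier) → Set ℓ
  VanishesOnRelators f =
    (∀ u v x y i → f (u ++ (x , i) ∷ (y , i) ∷ v) + f (u ++ (y , i) ∷ (x , i) ∷ v) ≈ 0#) ×
    (∀ u v x y i j → f (u ++ (x , i) ∷ (y , j) ∷ v) + (f (u ++ (y , i) ∷ (x , j) ∷ v) +
                      (f (u ++ (y , j) ∷ (x , i) ∷ v) + f (u ++ (x , j) ∷ (y , i) ∷ v))) ≈ 0#)

  eval-relatorAt : ∀ {f} → VanishesOnRelators f → ∀ u g v → eval f (relatorAt u g v) ≈ 0#
  eval-relatorAt (vanish₁ , _) u (rel₁ x y i) v =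
    ≈-trans (+-cong (*-identityˡ _) (≈-trans (+-identityʳ _) (*-identityˡ _))) (vanish₁ u v x y i)
  eval-relatorAt (_ , vanish₂) u (rel₂ x y i j) v =
    ≈-trans (+-cong (*-identityˡ _) (+-cong (*-identityˡ _) (+-cong (*-identityˡ _) (≈-trans (+-identityʳ _) (*-identityˡ _)))))
            (vanish₂ u v x y i j)

  placedScaled : Carrier → Word n → Word n → Carrier × Word n → Carrier × Word n
  placedScaled a u v (b , w) = (a * b , u ++ w ++ v)

  eval-placedScaled : ∀ f a u v t → eval f (map (placedScaled a u v) t) ≈ a * eval f (map (placed u v) t)
  eval-placedScaled f a u v []            = ≈-sym (zeroʳ a)
  eval-placedScaled f a u v ((b , w) ∷ t) = begin
    a * b * f (u ++ w ++ v) + eval f (map (placedScaled a u v) t)     ≈⟨ +-cong (*-assoc a b _) (eval-placedScaled f a u v t) ⟩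
    a * (b * f (u ++ w ++ v)) + a * eval f (map (placed u v) t)       ≈⟨ distribˡ a _ _ ⟨
    a * (b * f (u ++ w ++ v) + eval f (map (placed u v) t))           ∎

  eval-placedRelator : ∀ {f} → VanishesOnRelators f → ∀ a u g v s → eval f s ≈ 0# →
    eval f (map (placedScaled a u v) (genFS g) ++ s) ≈ 0#
  eval-placedRelator {f} vanish a u g v s s≈0 = begin
    eval f (map (placedScaled a u v) (genFS g) ++ s)        ≈⟨ eval-++ f (map (placedScaled a u v) (genFS g)) s ⟩
    eval f (map (placedScaled a u v) (genFS g)) + eval f s  ≈⟨ +-cong (eval-placedScaled f a u v (genFS g)) s≈0 ⟩
    a * eval f (relatorAt u g v) + 0#                       ≈⟨ +-identityʳ _ ⟩
    a * eval f (relatorAt u g v)                            ≈⟨ *-congˡ (eval-relatorAt vanish u g v) ⟩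
    a * 0#                                                  ≈⟨ zeroʳ a ⟩
    0#                                                      ∎

  -- The split on the generator lets the term of expand reduce to map (placedScaled a u v) (genFS g).
  eval-expand : ∀ {f} → VanishesOnRelators f → ∀ ws → eval f (expand ws) ≈ 0#
  eval-expand vanish []                                   = ≈-refl
  eval-expand vanish ((a , u , g@(rel₁ _ _ _)   , v) ∷ ws) = eval-placedRelator vanish a u g v (expand ws) (eval-expand vanish ws)
  eval-expand vanish ((a , u , g@(rel₂ _ _ _ _) , v) ∷ ws) = eval-placedRelator vanish a u g v (expand ws) (eval-expand vanish ws)

  eval-InI : ∀ {f s} → VanishesOnRelators f → InI s → eval f s ≈ 0#
  eval-InI {f} {s} vanish (ws , s≋ws) = ≈-trans (eval-resp-≋ f {s} {expand ws} s≋ws) (eval-expand {f} vanish ws)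

module Independence {c ℓ} (F : Field c ℓ) (μ : WeakComp) where
  open Field F renaming (refl to ≈-refl; sym to ≈-sym; trans to ≈-trans)
  open TensorAlgebra F ∣ μ ∣
  open FormalSums F ∣ μ ∣
  open ColoredWords ∣ μ ∣
  open import Relation.Binary.Reasoning.Setoid setoid
  open import Algebra.Properties.Group +-group using (⁻¹-involutive; ε⁻¹≈ε)
  open import Algebra.Properties.CommutativeSemigroup +-commutativeSemigroup using (x∙yz≈y∙xz)

  ⟦_⟧ : Sign → Carrier
  ⟦ pos ⟧ = 1#
  ⟦ neg ⟧ = - 1#
  ⟦ nul ⟧ = 0#

  ⟦opposite⟧ : ∀ a → ⟦ opposite a ⟧ ≈ - ⟦ a ⟧
  ⟦opposite⟧ pos = ≈-refl
  ⟦opposite⟧ neg = ≈-sym (⁻¹-involutive 1#)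
  ⟦opposite⟧ nul = ≈-sym ε⁻¹≈ε

  ⟦opposite⊙⟧ : ∀ a b → ⟦ opposite a ⊙ b ⟧ ≈ - ⟦ a ⊙ b ⟧
  ⟦opposite⊙⟧ a b = ≈-trans (reflexive (cong ⟦_⟧ (opposite-⊙ˡ a b))) (⟦opposite⟧ (a ⊙ b))

  ⟦⊙opposite⟧ : ∀ a b → ⟦ a ⊙ opposite b ⟧ ≈ - ⟦ a ⊙ b ⟧
  ⟦⊙opposite⟧ a b = ≈-trans (reflexive (cong ⟦_⟧ (opposite-⊙ʳ a b))) (⟦opposite⟧ (a ⊙ b))

  functional : Word ∣ μ ∣ → Word ∣ μ ∣ → Carrier
  functional t w = ⟦ sign t w ⟧

  functional-vanishes : ∀ t → VanishesOnRelators (functional t)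
  functional-vanishes t = vanish₁ , vanish₂
    where
    vanish₁ : ∀ u v x y i → functional t (u ++ (x , i) ∷ (y , i) ∷ v) + functional t (u ++ (y , i) ∷ (x , i) ∷ v) ≈ 0#
    vanish₁ u v x y i rewrite sign-++ t u v (x , i) (y , i) | sign-++ t u v (y , i) (x , i)
      with letterSign-or-colorSign-alternating t u v
    ... | inj₁ alt rewrite alt (toℕ x) (toℕ y) =
      ≈-trans (+-congʳ (⟦opposite⊙⟧ g h)) (-‿inverseˡ _)
      where
      g = letterSign t (map letterℕ u ++ toℕ y ∷ toℕ x ∷ map letterℕ v)
      h = colorSign t (map color u ++ i ∷ i ∷ map color v)
    ... | inj₂ alt rewrite opposite-fixed⇒nul _ (alt i i) =
      ≈-trans (+-cong (reflexive (cong ⟦_⟧ (⊙-zeroʳ g₁))) (reflexive (cong ⟦_⟧ (⊙-zeroʳ g₂)))) (+-identityʳ 0#)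
      where
      g₁ = letterSign t (map letterℕ u ++ toℕ x ∷ toℕ y ∷ map letterℕ v)
      g₂ = letterSign t (map letterℕ u ++ toℕ y ∷ toℕ x ∷ map letterℕ v)
    vanish₂ : ∀ u v x y i j →
      functional t (u ++ (x , i) ∷ (y , j) ∷ v) + (functional t (u ++ (y , i) ∷ (x , j) ∷ v) +
        (functional t (u ++ (y , j) ∷ (x , i) ∷ v) + functional t (u ++ (x , j) ∷ (y , i) ∷ v))) ≈ 0#
    vanish₂ u v x y i j
      rewrite sign-++ t u v (x , i) (y , j) | sign-++ t u v (y , i) (x , j)
            | sign-++ t u v (y , j) (x , i) | sign-++ t u v (x , j) (y , i)
      with letterSign-or-colorSign-alternating t u v
    ... | inj₁ alt rewrite alt (toℕ x) (toℕ y) = begin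
      ⟦ opposite g ⊙ h₁ ⟧ + (⟦ g ⊙ h₁ ⟧ + (⟦ g ⊙ h₂ ⟧ + ⟦ opposite g ⊙ h₂ ⟧))
        ≈⟨ +-cong (⟦opposite⊙⟧ g h₁) (+-congˡ (+-congˡ (⟦opposite⊙⟧ g h₂))) ⟩
      - ⟦ g ⊙ h₁ ⟧ + (⟦ g ⊙ h₁ ⟧ + (⟦ g ⊙ h₂ ⟧ + - ⟦ g ⊙ h₂ ⟧))
        ≈⟨ +-congˡ (+-congˡ (-‿inverseʳ _)) ⟩
      - ⟦ g ⊙ h₁ ⟧ + (⟦ g ⊙ h₁ ⟧ + 0#)   ≈⟨ +-congˡ (+-identityʳ _) ⟩
      - ⟦ g ⊙ h₁ ⟧ + ⟦ g ⊙ h₁ ⟧          ≈⟨ -‿inverseˡ _ ⟩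
      0#                                 ∎
      where
      g  = letterSign t (map letterℕ u ++ toℕ y ∷ toℕ x ∷ map letterℕ v)
      h₁ = colorSign t (map color u ++ i ∷ j ∷ map color v)
      h₂ = colorSign t (map color u ++ j ∷ i ∷ map color v)
    ... | inj₂ alt rewrite alt i j = begin
      ⟦ g₁ ⊙ opposite h ⟧ + (⟦ g₂ ⊙ opposite h ⟧ + (⟦ g₂ ⊙ h ⟧ + ⟦ g₁ ⊙ h ⟧))
        ≈⟨ +-cong (⟦⊙opposite⟧ g₁ h) (+-congʳ (⟦⊙opposite⟧ g₂ h)) ⟩
      - ⟦ g₁ ⊙ h ⟧ + (- ⟦ g₂ ⊙ h ⟧ + (⟦ g₂ ⊙ h ⟧ + ⟦ g₁ ⊙ h ⟧))
        ≈⟨ +-congˡ (+-assoc _ _ _) ⟨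
      - ⟦ g₁ ⊙ h ⟧ + ((- ⟦ g₂ ⊙ h ⟧ + ⟦ g₂ ⊙ h ⟧) + ⟦ g₁ ⊙ h ⟧)
        ≈⟨ +-congˡ (≈-trans (+-congʳ (-‿inverseˡ _)) (+-identityˡ _)) ⟩
      - ⟦ g₁ ⊙ h ⟧ + ⟦ g₁ ⊙ h ⟧           ≈⟨ -‿inverseˡ _ ⟩
      0#                                  ∎
      where
      g₁ = letterSign t (map letterℕ u ++ toℕ x ∷ toℕ y ∷ map letterℕ v)
      g₂ = letterSign t (map letterℕ u ++ toℕ y ∷ toℕ x ∷ map letterℕ v)
      h  = colorSign t (map color u ++ j ∷ i ∷ map color v)

  evalCombo : Word ∣ μ ∣ → List (Carrier × CWord ∣ μ ∣) → Carrier
  evalCombo t L = eval (functional t) (combo F μ L)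

  evalCombo-++ : ∀ t L₁ L₂ → evalCombo t (L₁ ++ L₂) ≈ evalCombo t L₁ + evalCombo t L₂
  evalCombo-++ t L₁ L₂ = ≈-trans (reflexive (cong (eval (functional t)) (ListP.map-++ _ L₁ L₂)))
                                 (eval-++ (functional t) (combo F μ L₁) (combo F μ L₂))

  evalCombo-middle : ∀ t L₁ a τ L₂ →
    evalCombo t (L₁ ++ (a , τ) ∷ L₂) ≈ a * functional t (toList τ) + evalCombo t (L₁ ++ L₂)
  evalCombo-middle t L₁ a τ L₂ = begin
    evalCombo t (L₁ ++ (a , τ) ∷ L₂)                                ≈⟨ evalCombo-++ t L₁ ((a , τ) ∷ L₂) ⟩
    evalCombo t L₁ + (a * functional t (toList τ) + evalCombo t L₂)  ≈⟨ x∙yz≈y∙xz _ _ _ ⟩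
    a * functional t (toList τ) + (evalCombo t L₁ + evalCombo t L₂)  ≈⟨ +-congˡ (evalCombo-++ t L₁ L₂) ⟨
    a * functional t (toList τ) + evalCombo t (L₁ ++ L₂)             ∎

  evalCombo-nul : ∀ t L → All (λ p → sign t (toList (proj₂ p)) ≡ nul) L → evalCombo t L ≈ 0#
  evalCombo-nul t []            []          = ≈-refl
  evalCombo-nul t ((a , σ) ∷ L) (≡nul ∷ ≡nuls) = begin
    a * ⟦ sign t (toList σ) ⟧ + evalCombo t L   ≈⟨ +-cong (*-congˡ (reflexive (cong ⟦_⟧ ≡nul))) (evalCombo-nul t L ≡nuls) ⟩
    a * 0# + 0#                                ≈⟨ +-identityʳ _ ⟩
    a * 0#                                     ≈⟨ zeroʳ a ⟩
    0#                                         ∎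

  triangular : ∀ τ σ → InNinc μ τ → key (toList τ) ≤ₗ key (toList σ) → σ ≢ τ → sign (toList τ) (toList σ) ≡ nul
  triangular τ σ ((perm , _) , ¬asc) τ≤σ σ≢τ with nul? (sign (toList τ) (toList σ))
  ... | inj₁ ≡nul = ≡nul
  ... | inj₂ ≢nul = ⊥-elim (σ≢τ (toList-injective′ σ τ (key-injective (toList σ) (toList τ) same-length
          (≤ₗ-antisym (sign-≤ₗ (toList τ) (toList σ) (nonincreasing⇒colorsFall τ perm ¬asc) ≢nul) τ≤σ))))
    where same-length = trans (VecP.length-toList σ) (sym (VecP.length-toList τ))

  -- The functional of a key-minimal τ kills every other σ, so it reads off the coefficient of τ.
  minimal-coefficient-vanishes : ∀ L₁ a τ L₂ → InNinc μ τ →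
    All (λ q → key (toList τ) ≤ₗ key (toList (proj₂ q)) × proj₂ q ≢ τ) (L₁ ++ L₂) →
    (∀ t → evalCombo t (L₁ ++ (a , τ) ∷ L₂) ≈ 0#) → a ≈ 0# × (∀ t → evalCombo t (L₁ ++ L₂) ≈ 0#)
  minimal-coefficient-vanishes L₁ a τ L₂ ninc@((perm , _) , ¬asc) others vanish = a≈0 , vanish′
    where
    others-nul : All (λ q → sign (toList τ) (toList (proj₂ q)) ≡ nul) (L₁ ++ L₂)
    others-nul = All.map (λ { {_ , σ} (τ≤σ , σ≢τ) → triangular τ σ ninc τ≤σ σ≢τ }) others
    a≈0 : a ≈ 0#
    a≈0 = begin
      a                                          ≈⟨ *-identityʳ a ⟨
      a * ⟦ pos ⟧                                ≈⟨ *-congˡ (reflexive (cong ⟦_⟧ τ-self)) ⟨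
      a * functional (toList τ) (toList τ)       ≈⟨ +-identityʳ _ ⟨
      a * functional (toList τ) (toList τ) + 0#
        ≈⟨ +-congˡ (evalCombo-nul (toList τ) (L₁ ++ L₂) others-nul) ⟨
      a * functional (toList τ) (toList τ) + evalCombo (toList τ) (L₁ ++ L₂)
        ≈⟨ evalCombo-middle (toList τ) L₁ a τ L₂ ⟨
      evalCombo (toList τ) (L₁ ++ (a , τ) ∷ L₂)  ≈⟨ vanish (toList τ) ⟩
      0#                                         ∎
      where τ-self = sign-self (toList τ) (nonincreasing⇒colorsFall τ perm ¬asc)
    vanish′ : ∀ t → evalCombo t (L₁ ++ L₂) ≈ 0#
    vanish′ t = begin
      evalCombo t (L₁ ++ L₂)                                ≈⟨ +-identityˡ _ ⟨
      0# + evalCombo t (L₁ ++ L₂)                           ≈⟨ +-congʳ (≈-trans (*-congʳ a≈0) (zeroˡ _)) ⟨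
      a * functional t (toList τ) + evalCombo t (L₁ ++ L₂)  ≈⟨ evalCombo-middle t L₁ a τ L₂ ⟨
      evalCombo t (L₁ ++ (a , τ) ∷ L₂)                      ≈⟨ vanish t ⟩
      0#                                                    ∎

  CoefficientsVanish : List (Carrier × CWord ∣ μ ∣) → Set (c ⊔ ℓ)
  CoefficientsVanish L = Unique (map proj₂ L) → All (λ p → InNinc μ (proj₂ p)) L →
    (∀ t → evalCombo t L ≈ 0#) → All (λ p → proj₁ p ≈ 0#) L

  coefficients-vanish : ∀ k L → length L ≤ k → CoefficientsVanish L
  coefficients-vanish _       []       _          _ _ _ = []
  coefficients-vanish (suc k) (p ∷ ps) (s≤s ps≤k)
    with extractMinimum ≤ₗ-trans ≤ₗ-total (λ q → key (toList (proj₂ q))) p ps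
  ... | L₁ , (a , τ) , L₂ , eq , minimal = subst CoefficientsVanish (sym eq) vanishes
    where
    shorter : length (L₁ ++ L₂) ≤ k
    shorter = subst (_≤ k) (ℕP.suc-injective (trans (cong length eq) (ListP.length-++-sucʳ L₁ (a , τ) L₂))) ps≤k
    vanishes : CoefficientsVanish (L₁ ++ (a , τ) ∷ L₂)
    vanishes unique ninc vanish =
      let others , unique′ = Unique-remove proj₂ L₁ (a , τ) L₂ unique
          a≈0 , vanish′    = minimal-coefficient-vanishes L₁ a τ L₂ (All.head (AllP.++⁻ʳ L₁ ninc))
                               (All.zip (minimal , others)) vanish
          rest = coefficients-vanish k (L₁ ++ L₂) shorter unique′
                   (AllP.++⁺ (AllP.++⁻ˡ L₁ ninc) (All.tail (AllP.++⁻ʳ L₁ ninc))) vanish′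
      in AllP.++⁺ (AllP.++⁻ˡ L₁ rest) (a≈0 ∷ AllP.++⁻ʳ L₁ rest)

  linearIndependence : NincLinIndep F μ
  linearIndependence L unique ninc inI =
    coefficients-vanish (length L) L ℕP.≤-refl unique ninc λ t → eval-InI {s = combo F μ L} (functional-vanishes t) inI

module Spanning {c ℓ} (F : Field c ℓ) (μ : WeakComp) where
  open Field F renaming (refl to ≈-refl; sym to ≈-sym; trans to ≈-trans)
  open TensorAlgebra F ∣ μ ∣
  open FormalSums F ∣ μ ∣
  open ColoredWords ∣ μ ∣

  Represented : FS → Set (c ⊔ ℓ)
  Represented s = ∃ λ L → All (λ p → InNinc μ (proj₂ p)) L × InI (s − combo F μ L)

  represented-ninc : ∀ σ → InNinc μ σ → Represented (⊗w (toList σ))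
  represented-ninc σ ninc =
    (1# , σ) ∷ [] , ninc ∷ [] , InI-resp {[]} {⊗w (toList σ) − ⊗w (toList σ)} cancels ([] , λ _ → ≈-refl)
    where
    cancels : [] ≋ (⊗w (toList σ) − ⊗w (toList σ))
    cancels w with toList σ ≟W w
    ... | yes σ≡w with toList σ ≟W w
    ...   | yes _   = ≈-sym (≈-trans (+-congˡ (+-identityʳ _)) (-‿inverseʳ 1#))
    ...   | no  σ≢w = ⊥-elim (σ≢w σ≡w)
    cancels w | no σ≢w with toList σ ≟W w
    ...   | yes σ≡w = ⊥-elim (σ≢w σ≡w)
    ...   | no  _   = ≈-refl

  represented-++ : ∀ {s t} → Represented s → Represented t → Represented (s ++ t)
  represented-++ {s} {t} (Ls , ninc-s , s≡) (Lt , ninc-t , t≡) =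
    Ls ++ Lt , AllP.++⁺ ninc-s ninc-t ,
    subst (λ u → InI ((s ++ t) − u)) (sym (ListP.map-++ _ Ls Lt))
      (InI-resp {(s − combo F μ Ls) ++ (t − combo F μ Lt)} {(s ++ t) − (combo F μ Ls ++ combo F μ Lt)}
        (−-++ s t (combo F μ Ls) (combo F μ Lt))
        (InI-++ {s − combo F μ Ls} s≡ t≡))

  negateCoefficients : List (Carrier × CWord ∣ μ ∣) → List (Carrier × CWord ∣ μ ∣)
  negateCoefficients = map (λ p → (- proj₁ p , proj₂ p))

  combo-negateCoefficients : ∀ L → combo F μ (negateCoefficients L) ≡ negFS (combo F μ L)
  combo-negateCoefficients []      = refl
  combo-negateCoefficients (p ∷ L) = cong (_ ∷_) (combo-negateCoefficients L)

  represented-opposite : ∀ {s t} → InI (s ++ t) → Represented t → Represented s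
  represented-opposite {s} {t} s+t∈I (L , ninc , t≡) =
    negateCoefficients L , AllP.map⁺ ninc ,
    subst (λ u → InI (s − u)) (sym (combo-negateCoefficients L))
      (InI-resp {(s ++ t) ++ negFS (t − combo F μ L)} {s − negFS (combo F μ L)} (−-cancel s t (combo F μ L))
        (InI-++ {s ++ t} s+t∈I (InI-neg {t − combo F μ L} t≡)))

  In𝔖-move : ∀ {σ σ′ : CWord ∣ μ ∣} pre post {a b a′ b′} →
    toList σ ≡ pre ++ a ∷ b ∷ post → toList σ′ ≡ pre ++ a′ ∷ b′ ∷ post →
    SameOrSwapped letter a b a′ b′ → SameOrSwapped color a b a′ b′ → In𝔖 μ σ → In𝔖 μ σ′
  In𝔖-move {σ} {σ′} pre post eq eq′ letters colors (perm , content) = perm′ , content′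
    where
    perm′ : IsColoredPerm σ′
    perm′ = Unique-map-toList⁻ letter σ′ (subst (λ w → Unique (map letter w)) (sym eq′)
              (map-adjacent-move letter Unique Unique-swap pre post letters
                (subst (λ w → Unique (map letter w)) eq (Unique-map-toList⁺ letter σ perm))))
    content′ : HasContent μ σ′
    content′ k = trans (length-filter-map color (ℕP._≟ k) (toList σ′))
      (subst (λ w → Count (map color w)) (sym eq′)
        (map-adjacent-move color Count (λ xs x y ys → trans (sym (length-filter-swap (ℕP._≟ k) xs x y ys))) pre post colors
          (subst (λ w → Count (map color w)) eq (trans (sym (length-filter-map color (ℕP._≟ k) (toList σ))) (content k)))))
      where
      Count : List ℕ → Set
      Count cs = length (filter (ℕP._≟ k) cs) ≡ μAt μ k

  StraightensBelow : CWord ∣ μ ∣ → Set (c ⊔ ℓ)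
  StraightensBelow σ = ∀ σ′ → In𝔖 μ σ′ → disorder (toList σ′) < disorder (toList σ) → Represented (⊗w (toList σ′))

  moveAdjacent : ∀ σ → In𝔖 μ σ → StraightensBelow σ → ∀ pre post {a b} → toList σ ≡ pre ++ a ∷ b ∷ post →
    ∀ a′ b′ → SameOrSwapped letter a b a′ b′ → SameOrSwapped color a b a′ b′ →
    disorder (pre ++ a′ ∷ b′ ∷ post) < disorder (pre ++ a ∷ b ∷ post) → Represented (⊗w (pre ++ a′ ∷ b′ ∷ post))
  moveAdjacent σ σ∈𝔖 recurse pre post eq a′ b′ letters colors smaller =
    let σ′ , eq′ = replaceAdjacent σ pre post eq a′ b′ in
    subst (λ w → Represented (⊗w w)) eq′
      (recurse σ′ (In𝔖-move pre post eq eq′ letters colors σ∈𝔖)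
        (subst₂ _<_ (cong disorder (sym eq′)) (cong disorder (sym eq)) smaller))

  -- An ascent x^i y^j (x < y, i ≤ j) is rewritten by a defining relation of I into words of smaller disorder.
  straightenAscent : ∀ σ → In𝔖 μ σ → StraightensBelow σ → ∀ pre post {x i y j} →
    toList σ ≡ pre ++ (x , i) ∷ (y , j) ∷ post → toℕ x < toℕ y → i ≤ j → Represented (⊗w (toList σ))
  straightenAscent σ σ∈𝔖 recurse pre post {x} {i} {y} {j} eq x<y i≤j with i ℕP.≟ j
  ... | yes refl = represented-opposite {⊗w (toList σ)} {⊗w (pre ++ (y , i) ∷ (x , i) ∷ post)}
    (subst (λ w → InI (⊗w w ++ ⊗w (pre ++ (y , i) ∷ (x , i) ∷ post))) (sym eq) (InI-relatorAt pre (rel₁ x y i) post))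
    (move (y , i) (x , i) (inj₂ (refl , refl)) (inj₁ (refl , refl)) (disorder-swapLetters pre post i i x<y))
    where move = moveAdjacent σ σ∈𝔖 recurse pre post eq
  ... | no i≢j = represented-opposite {⊗w (toList σ)} {⊗w w₁ ++ (⊗w w₂ ++ ⊗w w₃)}
    (subst (λ w → InI (⊗w w ++ (⊗w w₁ ++ (⊗w w₂ ++ ⊗w w₃)))) (sym eq) (InI-relatorAt pre (rel₂ x y i j) post))
    (represented-++ {⊗w w₁} (move (y , i) (x , j) (inj₂ (refl , refl)) (inj₁ (refl , refl)) (disorder-swapLetters pre post i j x<y))
      (represented-++ {⊗w w₂} (move (y , j) (x , i) (inj₂ (refl , refl)) (inj₂ (refl , refl)) (disorder-swapBoth pre post x<y i<j))
                      (move (x , j) (y , i) (inj₁ (refl , refl)) (inj₂ (refl , refl)) (disorder-swapColors pre post x y i<j))))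
    where
    move = moveAdjacent σ σ∈𝔖 recurse pre post eq
    i<j = ℕP.≤∧≢⇒< i≤j i≢j
    w₁ = pre ++ (y , i) ∷ (x , j) ∷ post
    w₂ = pre ++ (y , j) ∷ (x , i) ∷ post
    w₃ = pre ++ (x , j) ∷ (y , i) ∷ post

  straighten : ∀ σ → In𝔖 μ σ → Acc _<_ (disorder (toList σ)) → Represented (⊗w (toList σ))
  straighten σ σ∈𝔖 (acc smaller) with firstAdjacent ascentPair? (toList σ)
  ... | inj₂ free = represented-ninc σ (σ∈𝔖 , ascentFree⇒¬Ascent σ free)
  ... | inj₁ (pre , (x , i) , (y , j) , post , eq , (x<y , i≤j)) =
    straightenAscent σ σ∈𝔖 (λ σ′ σ′∈𝔖 lt → straighten σ′ σ′∈𝔖 (smaller lt)) pre post eq x<y i≤j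

  spanning : NincSpans F μ
  spanning σ σ∈𝔖 = straighten σ σ∈𝔖 (<-wellFounded (disorder (toList σ)))

theorem2p3 : ∀ {c ℓ} (F : Field c ℓ) → CharNot2 F → (μ : WeakComp) → NincIsBasis F μ
theorem2p3 F _ μ = Independence.linearIndependence F μ , Spanning.spanning F μ
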